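{- Let $P\subseteq M_{\mathbb R}$ be a simplicial reflexive polytope with facets $F$ and $-F$. Let the vertices of $F$ be $e_1,\dots,e_d$ and let $e_1^*,\dots,e_d^*$ be the dual $\mathbb R$-basis of $N_{\mathbb R}$. For $i=1,\dots,d$ let $F_i$ be the unique facet of $P$ with $F_i\cap F=\mathrm{conv}(e_j: j\ne i)$. Set $u:=\eta_F$. Let $v$ be a vertex of $P$ with $\langle u,v\rangle=0$, and write $v=\sum_{i=1}^d q_ie_i$ with $q_i\in\mathbb Q$. Then for each $i=1,\dots,d$: $$q_i<0\iff q_i=-1\iff v\in F_i,$$ and in this case $e_i^*=\eta_{F_i}-u\in P^*\cap N$. Moreover there are $I,J\subseteq\{1,\dots,d\}$ with $I\cap J=\emptyset$ and $|I|=|J|$ such that $v=\sum_{j\in J}e_j-\sum_{i\in I}e_i$.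
   Context: $M\cong\mathbb Z^d$ is a lattice, $N=\mathrm{Hom}(M,\mathbb Z)$ with pairing $\langle\cdot,\cdot\rangle$. A reflexive polytope is a $d$-dimensional lattice polytope $P\subseteq M_{\mathbb R}$ with $0$ in its interior, primitive vertices, and dual $P^*=\{x\in N_{\mathbb R}:\langle x,y\rangle\ge-1\ \forall y\in P\}$ a lattice polytope; simplicial means all facets are simplices. For a facet $G$ of $P$, $\eta_G\in N_{\mathbb R}$ is the unique vector with $\langle\eta_G,y\rangle=-1$ for all $y\in G$ (a vertex of $P^*$). Note $e_1,\dots,e_d$ need not be a lattice basis.
   Formalization: The spaces $M_{\mathbb R}$ and $N_{\mathbb R}$ are replaced by ℚ^d, so P, its facets and $P^*$ contain only their rational points. -}

module Defs where

open import Level using (0ℓ)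
open import Data.Nat using (ℕ; zero; suc)
open import Data.Fin using (Fin; zero; suc)
open import Data.Integer using (ℤ; +_)
open import Data.Rational using (ℚ; 0ℚ; 1ℚ; _+_; _*_; -_; _-_; _≤_; _<_; _/_)
open import Data.Product using (Σ; ∃; _×_; _,_)
open import Relation.Binary.PropositionalEquality using (_≡_; _≢_)
open import Relation.Unary using (Pred)
open import Function.Bundles using (_⇔_)

-- Conventions: M = N = ℤ^d, M_ℝ and N_ℝ are replaced by ℚ^d (all data
-- in the statement is rational), pairing = standard dot product.
Vect : ℕ → Set
Vect d = Fin d → ℚ

embed : ∀ {d} → (Fin d → ℤ) → Vect d
embed w i = w i / 1

_≋_ : ∀ {d} → Vect d → Vect d → Set
x ≋ y = ∀ i → x i ≡ y i

zeroV : ∀ {d} → Vect d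
zeroV i = 0ℚ

_+V_ : ∀ {d} → Vect d → Vect d → Vect d
(x +V y) i = x i + y i

_-V_ : ∀ {d} → Vect d → Vect d → Vect d
(x -V y) i = x i - y i

_·V_ : ∀ {d} → ℚ → Vect d → Vect d
(t ·V x) i = t * x i

Σℚ : ∀ {k} → (Fin k → ℚ) → ℚ
Σℚ {zero} f = 0ℚ
Σℚ {suc k} f = f zero + Σℚ (λ j → f (suc j))

ΣV : ∀ {k d} → (Fin k → Vect d) → Vect d
ΣV {zero} f = zeroV
ΣV {suc k} f = f zero +V ΣV (λ j → f (suc j))

⟨_,_⟩ : ∀ {d} → Vect d → Vect d → ℚ
⟨ x , y ⟩ = Σℚ (λ i → x i * y i)

-1ℚ : ℚ
-1ℚ = - 1ℚ

Integral : ∀ {d} → Vect d → Set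
Integral {d} x = Σ (Fin d → ℤ) λ w → x ≋ embed w

Conv : ∀ {k d} → (Fin k → Vect d) → Pred (Vect d) 0ℓ
Conv {k} p y = Σ (Fin k → ℚ) λ c →
  (∀ j → 0ℚ ≤ c j) × (Σℚ c ≡ 1ℚ) × (y ≋ ΣV (λ j → c j ·V p j))

ConvExcept : ∀ {k d} → (Fin k → Vect d) → Fin k → Pred (Vect d) 0ℓ
ConvExcept {k} p i y = Σ (Fin k → ℚ) λ c →
  (∀ j → 0ℚ ≤ c j) × (c i ≡ 0ℚ) × (Σℚ c ≡ 1ℚ) × (y ≋ ΣV (λ j → c j ·V p j))

polytope : ∀ {k d} → (Fin k → Fin d → ℤ) → Pred (Vect d) 0ℓ
polytope gens = Conv (λ j → embed (gens j))

AffInd : ∀ {k d} → (Fin k → Vect d) → Set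
AffInd {k} p = (c : Fin k → ℚ) → Σℚ c ≡ 0ℚ →
  ΣV (λ j → c j ·V p j) ≋ zeroV → ∀ j → c j ≡ 0ℚ

IsVertex : ∀ {d} → Pred (Vect d) 0ℓ → Vect d → Set
IsVertex S x = S x × (∀ a b t → S a → S b → 0ℚ < t → t < 1ℚ →
  x ≋ ((t ·V a) +V ((1ℚ - t) ·V b)) → a ≋ b)

Primitive : ∀ {d} → Vect d → Set
Primitive {d} x = Integral x ×
  ((k : ℕ) (w : Fin d → ℤ) → x ≋ ((+ k / 1) ·V embed w) → k ≡ 1)

ZeroInInterior : ∀ {d} → Pred (Vect d) 0ℓ → Set
ZeroInInterior {d} S = Σ ℚ λ ε → (0ℚ < ε) ×
  ((y : Vect d) → (∀ i → (- ε ≤ y i) × (y i ≤ ε)) → S y)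

Dual : ∀ {d} → Pred (Vect d) 0ℓ → Pred (Vect d) 0ℓ
Dual S x = ∀ y → S y → -1ℚ ≤ ⟨ x , y ⟩

IsLatticePolytope : ∀ {d} → Pred (Vect d) 0ℓ → Set
IsLatticePolytope {d} S = Σ ℕ λ k → Σ (Fin k → Fin d → ℤ) λ W →
  ∀ x → S x ⇔ polytope W x

-- facet: a face cut out by a supporting hyperplane, of dimension d-1
IsFacet : ∀ {d} → Pred (Vect d) 0ℓ → Pred (Vect d) 0ℓ → Set
IsFacet {d} S G =
  (Σ (Vect d) λ a → Σ ℚ λ c → (∃ λ i → a i ≢ 0ℚ) ×
     (∀ y → S y → c ≤ ⟨ a , y ⟩) ×
     (∀ y → G y ⇔ (S y × (⟨ a , y ⟩ ≡ c)))) ×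
  (Σ (Fin d → Vect d) λ p → (∀ j → G (p j)) × AffInd p)

IsSimplicial : ∀ {d} → Pred (Vect d) 0ℓ → Set₁
IsSimplicial {d} S = ∀ G → IsFacet S G → ∀ k (w : Fin k → Vect d) →
  (∀ j j' → w j ≋ w j' → j ≡ j') →
  (∀ j → IsVertex S (w j) × G (w j)) → AffInd w

IsReflexive : ∀ {d} → Pred (Vect d) 0ℓ → Set
IsReflexive S = ZeroInInterior S ×
  (∀ v → IsVertex S v → Primitive v) ×
  IsLatticePolytope (Dual S)

IsEta : ∀ {d} → Pred (Vect d) 0ℓ → Vect d → Set
IsEta G η = ∀ y → G y → ⟨ η , y ⟩ ≡ -1ℚ

negSet : ∀ {d} → Pred (Vect d) 0ℓ → Pred (Vect d) 0ℓ
negSet G y = G (λ i → - y i)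

open import Data.Bool using (if_then_else_)
open import Data.Fin.Subset using (Subset)
open import Data.Vec using (lookup)

ΣSub : ∀ {k d} → Subset k → (Fin k → Vect d) → Vect d
ΣSub J p = ΣV (λ j → if lookup J j then p j else zeroV)

open import Relation.Nullary using (yes; no)
open import Data.Fin using (_≟_)
δ : ∀ {k} → Fin k → Fin k → ℚ
δ i j with i ≟ j
... | yes _ = 1ℚ
... | no _ = 0ℚ

-- Dual to e, every normal of a facet through the e_j (j ≠ i) has the form u + γ e*_i.
-- For the normal η_i of F_i one gets γ_i > 0; as -u is the normal of -F, also -e_i ∈ P,
-- and ⟨η_i , -e_i⟩ ≥ -1 gives γ_i ≤ 2. Since P* is a lattice polytope and η_i is one of
-- its vertices, γ_i ∈ {1, 2}, and ⟨η_i , v⟩ = γ_i q_i is an integer ≥ -1. So q_i < 0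
-- forces γ_i q_i = -1, and γ_i = 2 is impossible: F_i would then contain -e_i, the e_j
-- (j ≠ i) and v, and v = Σ q_j e_j with Σ_j ±q_j = 1 is an affine relation among
-- vertices of a simplicial facet. A positive q_l is handled in the same way with the
-- vertex -(u + T e*_l) of P* reached by moving -u in direction -e*_l as far as P*
-- allows. Hence q ∈ {-1, 0, 1}^d, and Σ q_i = -⟨u , v⟩ = 0 balances the signs.
module Submission where

open import Defs
open import Level using (0ℓ)
open import Data.Nat using (ℕ)
open import Data.Fin using (Fin)
open import Data.Fin.Subset using (Subset; _∈_; _∉_; ∣_∣)
open import Data.Integer using (ℤ)
open import Data.Rational using (ℚ; 0ℚ; _<_)
open import Data.Product using (Σ; ∃; _×_; _,_)
open import Relation.Binary.PropositionalEquality using (_≡_)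
open import Relation.Unary using (Pred)
open import Function.Bundles using (_⇔_)

open import Algebra.Bundles using (CommutativeRing)
open import Data.Bool using (Bool; true; false; if_then_else_)
open import Data.Bool.Properties using (T-≡)
open import Data.Empty using (⊥; ⊥-elim)
open import Data.Fin using (zero; suc; punchIn; punchOut) renaming (_≟_ to _≟ᶠ_)
open import Data.Fin.Properties using (suc-injective; punchIn-punchOut; ¬∀⟶∃¬; all?)
import Data.Integer as ℤ
import Data.Integer.Properties as ℤ
open import Data.List using (_∷_; [])
open import Data.Nat using (zero; suc; s≤s; z≤n) renaming (_<_ to _<ℕ_)
open import Data.Nat.Properties using (n<1+n)
open import Data.Product using (proj₁; proj₂)
import Data.Product as Product
open import Data.Rational
  using (1ℚ; _+_; _*_; -_; _-_; _≤_; _/_; 1/_; ≢-nonZero; nonNegative; positive; negative; *≤*; *<*; toℚᵘ)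
open import Data.Rational.Properties
open import Data.Rational.Unnormalised using (mkℚᵘ) renaming (_≃_ to _≃ᵘ_; _+_ to _+ᵘ_; _*_ to _*ᵘ_)
import Data.Rational.Unnormalised as ℚᵘ
import Data.Rational.Unnormalised.Properties as ℚᵘ
open import Data.Sum using (_⊎_; inj₁; inj₂; [_,_]′)
open import Data.Vec using (tabulate; lookup)
open import Data.Vec.Properties using (lookup∘tabulate; []=⇒lookup)
open import Function.Base using (_∘_; id)
open import Function.Bundles using (mk⇔; Equivalence)
open import Relation.Binary.Definitions using (Tri; tri<; tri≈; tri>)
open import Relation.Binary.PropositionalEquality
  using (_≢_; refl; sym; trans; cong; cong₂; subst; subst₂; module ≡-Reasoning)
open import Relation.Nullary using (¬_; Dec; yes; no)
open import Relation.Nullary.Decidable.Core using (dec⇒maybe; isYes; toWitness)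
open import Tactic.RingSolver using (solve-∀; solve)
open import Tactic.RingSolver.Core.AlmostCommutativeRing using (AlmostCommutativeRing; fromCommutativeRing)

open import Algebra.Properties.Group +-0-group
  using () renaming (⁻¹-involutive to neg-involutive; x∙y⁻¹≈ε⇒x≈y to p-q≡0⇒p≡q)
open import Algebra.Properties.Ring +-*-ring using (-1*x≈-x)
open import Algebra.Properties.Semiring.Sum (CommutativeRing.semiring +-*-commutativeRing)
  using (sum; ∑-distrib-+; ∑-comm; *-distribˡ-sum)

open Equivalence using (to; from)

-- Arithmetic in ℚ

ℚ-ring : AlmostCommutativeRing 0ℓ 0ℓ
ℚ-ring = fromCommutativeRing +-*-commutativeRing (λ x → dec⇒maybe (0ℚ ≟ x))

0<1 : 0ℚ < 1ℚ
0<1 = *<* (ℤ.+<+ (s≤s z≤n))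

-1<0 : -1ℚ < 0ℚ
-1<0 = *<* ℤ.-<+

-1≢0 : -1ℚ ≢ 0ℚ
-1≢0 ()

*-1≡neg : ∀ x → x * -1ℚ ≡ - x
*-1≡neg x = trans (*-comm x -1ℚ) (-1*x≈-x x)

>⇒≢ : ∀ {a} → 0ℚ < a → a ≢ 0ℚ
>⇒≢ a>0 a≡0 = <-irrefl (sym a≡0) a>0

0≤* : ∀ {a b} → 0ℚ ≤ a → 0ℚ ≤ b → 0ℚ ≤ a * b
0≤* {a} {b} 0≤a 0≤b =
  nonNegative⁻¹ _ {{nonNeg*nonNeg⇒nonNeg a {{nonNegative 0≤a}} b {{nonNegative 0≤b}}}}

0<* : ∀ {a b} → 0ℚ < a → 0ℚ < b → 0ℚ < a * b
0<* {a} {b} 0<a 0<b = positive⁻¹ _ {{pos*pos⇒pos a {{positive 0<a}} b {{positive 0<b}}}}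

0≤*⇒0≤ : ∀ {a b} → 0ℚ < a → 0ℚ ≤ a * b → 0ℚ ≤ b
0≤*⇒0≤ {a} {b} 0<a 0≤ab = *-cancelˡ-≤-pos a {{positive 0<a}} (subst (_≤ a * b) (sym (*-zeroʳ a)) 0≤ab)

≤⇒0≤- : ∀ {a b} → a ≤ b → 0ℚ ≤ b - a
≤⇒0≤- {a} {b} a≤b = subst (_≤ b - a) (+-inverseʳ a) (+-monoˡ-≤ (- a) a≤b)

0≤-⇒≤ : ∀ {a b} → 0ℚ ≤ b - a → a ≤ b
0≤-⇒≤ {a} {b} 0≤b-a = subst₂ _≤_ (+-identityˡ a) b-a+a≡b (+-monoˡ-≤ a 0≤b-a)
  where
  b-a+a≡b : b - a + a ≡ b
  b-a+a≡b = solve (a ∷ b ∷ []) ℚ-ring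

<⇒0<- : ∀ {a b} → a < b → 0ℚ < b - a
<⇒0<- {a} {b} a<b = subst (_< b - a) (+-inverseʳ a) (+-monoˡ-< (- a) a<b)

≤∧≢⇒< : ∀ {a b} → a ≤ b → a ≢ b → a < b
≤∧≢⇒< {a} {b} a≤b a≢b with <-cmp a b
... | tri< a<b _ _ = a<b
... | tri≈ _ a≡b _ = ⊥-elim (a≢b a≡b)
... | tri> _ _ b<a = ⊥-elim (<-irrefl refl (<-≤-trans b<a a≤b))

nonNeg+nonNeg≡0 : ∀ {x y} → 0ℚ ≤ x → 0ℚ ≤ y → x + y ≡ 0ℚ → x ≡ 0ℚ
nonNeg+nonNeg≡0 {x} {y} 0≤x 0≤y x+y≡0 =
  ≤-antisym (subst₂ _≤_ (+-identityʳ x) x+y≡0 (+-monoʳ-≤ x 0≤y)) 0≤x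

-- Total inverse, with the junk value 0⁻¹ = 0.
_⁻¹ : ℚ → ℚ
p ⁻¹ with p ≟ 0ℚ
... | yes _ = 0ℚ
... | no p≢0 = 1/ p
  where instance _ = ≢-nonZero p≢0

⁻¹-inverseˡ : ∀ {p} → p ≢ 0ℚ → p ⁻¹ * p ≡ 1ℚ
⁻¹-inverseˡ {p} p≢0 with p ≟ 0ℚ
... | yes p≡0 = ⊥-elim (p≢0 p≡0)
... | no p≢0 = *-inverseˡ p
  where instance _ = ≢-nonZero p≢0

⁻¹-pos : ∀ {p} → 0ℚ < p → 0ℚ < p ⁻¹
⁻¹-pos {p} 0<p with p ≟ 0ℚ
... | yes p≡0 = ⊥-elim (<-irrefl (sym p≡0) 0<p)
... | no p≢0 = positive⁻¹ _ {{1/pos⇒pos p {{positive 0<p}}}}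

*-cancelˡ-≡ : ∀ {a b c} → a ≢ 0ℚ → a * b ≡ a * c → b ≡ c
*-cancelˡ-≡ {a} {b} {c} a≢0 ab≡ac = begin
  b                 ≡⟨ solve (b ∷ []) ℚ-ring ⟩
  1ℚ * b            ≡⟨ cong (_* b) (⁻¹-inverseˡ a≢0) ⟨
  a ⁻¹ * a * b      ≡⟨ *-assoc (a ⁻¹) a b ⟩
  a ⁻¹ * (a * b)    ≡⟨ cong (a ⁻¹ *_) ab≡ac ⟩
  a ⁻¹ * (a * c)    ≡⟨ *-assoc (a ⁻¹) a c ⟨
  a ⁻¹ * a * c      ≡⟨ cong (_* c) (⁻¹-inverseˡ a≢0) ⟩
  1ℚ * c            ≡⟨ solve (c ∷ []) ℚ-ring ⟩
  c                 ∎
  where open ≡-Reasoning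

*-eq-zero : ∀ {a b} → a ≢ 0ℚ → a * b ≡ 0ℚ → b ≡ 0ℚ
*-eq-zero {a} a≢0 ab≡0 = *-cancelˡ-≡ a≢0 (trans ab≡0 (sym (*-zeroʳ a)))

convex-≡-lower : ∀ {t a b m} → 0ℚ < t → t < 1ℚ → m ≤ a → m ≤ b →
  t * a + (1ℚ - t) * b ≡ m → a ≡ m × b ≡ m
convex-≡-lower {t} {a} {b} {m} 0<t t<1 m≤a m≤b tight =
  p-q≡0⇒p≡q _ _ (*-eq-zero (>⇒≢ 0<t) (nonNeg+nonNeg≡0 0≤A 0≤B A+B≡0)) ,
  p-q≡0⇒p≡q _ _ (*-eq-zero (>⇒≢ (<⇒0<- t<1))
    (nonNeg+nonNeg≡0 0≤B 0≤A (trans (+-comm ((1ℚ - t) * (b - m)) (t * (a - m))) A+B≡0)))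
  where
  open ≡-Reasoning
  0≤A : 0ℚ ≤ t * (a - m)
  0≤A = 0≤* (<⇒≤ 0<t) (≤⇒0≤- m≤a)
  0≤B : 0ℚ ≤ (1ℚ - t) * (b - m)
  0≤B = 0≤* (<⇒≤ (<⇒0<- t<1)) (≤⇒0≤- m≤b)
  A+B≡0 : t * (a - m) + (1ℚ - t) * (b - m) ≡ 0ℚ
  A+B≡0 = begin
    t * (a - m) + (1ℚ - t) * (b - m)  ≡⟨ solve (t ∷ a ∷ b ∷ m ∷ []) ℚ-ring ⟩
    (t * a + (1ℚ - t) * b) - m        ≡⟨ cong (_- m) tight ⟩
    m - m                             ≡⟨ +-inverseʳ m ⟩
    0ℚ                                ∎

convex-≡-upper : ∀ {t a b m} → 0ℚ < t → t < 1ℚ → a ≤ m → b ≤ m →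
  t * a + (1ℚ - t) * b ≡ m → a ≡ m × b ≡ m
convex-≡-upper {t} {a} {b} {m} 0<t t<1 a≤m b≤m tight =
  Product.map neg-injective neg-injective
    (convex-≡-lower 0<t t<1 (neg-antimono-≤ a≤m) (neg-antimono-≤ b≤m) negated)
  where
  open ≡-Reasoning
  negated : t * (- a) + (1ℚ - t) * (- b) ≡ - m
  negated = begin
    t * (- a) + (1ℚ - t) * (- b)  ≡⟨ solve (t ∷ a ∷ b ∷ []) ℚ-ring ⟩
    - (t * a + (1ℚ - t) * b)      ≡⟨ cong -_ tight ⟩
    - m                           ∎

IsSign : ℚ → Set
IsSign s = s ≡ 1ℚ ⊎ s ≡ -1ℚ

IsSign-* : ∀ {s s′} → IsSign s → IsSign s′ → IsSign (s * s′)
IsSign-* (inj₁ refl) (inj₁ refl) = inj₁ refl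
IsSign-* (inj₁ refl) (inj₂ refl) = inj₂ refl
IsSign-* (inj₂ refl) (inj₁ refl) = inj₂ refl
IsSign-* (inj₂ refl) (inj₂ refl) = inj₁ refl

IsSign-squared : ∀ {s} → IsSign s → s * s ≡ 1ℚ
IsSign-squared (inj₁ refl) = refl
IsSign-squared (inj₂ refl) = refl

IsSign⇒≢0 : ∀ {s} → IsSign s → s ≢ 0ℚ
IsSign⇒≢0 (inj₁ refl) ()
IsSign⇒≢0 (inj₂ refl) ()

-- Finite sums and the pairing

Σℚ≡sum : ∀ {k} (f : Fin k → ℚ) → Σℚ f ≡ sum f
Σℚ≡sum {zero} f = refl
Σℚ≡sum {suc k} f = cong (f zero +_) (Σℚ≡sum (f ∘ suc))

Σℚ-cong : ∀ {k} {f g : Fin k → ℚ} → (∀ j → f j ≡ g j) → Σℚ f ≡ Σℚ g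
Σℚ-cong {zero} f≗g = refl
Σℚ-cong {suc k} f≗g = cong₂ _+_ (f≗g zero) (Σℚ-cong (f≗g ∘ suc))

Σℚ-zero : ∀ {k} {f : Fin k → ℚ} → (∀ j → f j ≡ 0ℚ) → Σℚ f ≡ 0ℚ
Σℚ-zero {zero} f≗0 = refl
Σℚ-zero {suc k} f≗0 = trans (cong₂ _+_ (f≗0 zero) (Σℚ-zero (f≗0 ∘ suc))) (+-identityˡ 0ℚ)

Σℚ-distrib-+ : ∀ {k} (f g : Fin k → ℚ) → Σℚ (λ j → f j + g j) ≡ Σℚ f + Σℚ g
Σℚ-distrib-+ f g = begin
  Σℚ (λ j → f j + g j)  ≡⟨ Σℚ≡sum (λ j → f j + g j) ⟩
  sum (λ j → f j + g j) ≡⟨ ∑-distrib-+ f g ⟩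
  sum f + sum g         ≡⟨ cong₂ _+_ (Σℚ≡sum f) (Σℚ≡sum g) ⟨
  Σℚ f + Σℚ g           ∎
  where open ≡-Reasoning

*-distribˡ-Σℚ : ∀ {k} (a : ℚ) (f : Fin k → ℚ) → a * Σℚ f ≡ Σℚ (λ j → a * f j)
*-distribˡ-Σℚ a f = begin
  a * Σℚ f              ≡⟨ cong (a *_) (Σℚ≡sum f) ⟩
  a * sum f             ≡⟨ *-distribˡ-sum a f ⟩
  sum (λ j → a * f j)   ≡⟨ Σℚ≡sum (λ j → a * f j) ⟨
  Σℚ (λ j → a * f j)    ∎
  where open ≡-Reasoning

Σℚ-comm : ∀ {k m} (f : Fin k → Fin m → ℚ) →
  Σℚ (λ i → Σℚ (λ j → f i j)) ≡ Σℚ (λ j → Σℚ (λ i → f i j))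
Σℚ-comm f = begin
  Σℚ (λ i → Σℚ (λ j → f i j))   ≡⟨ Σℚ-cong (λ i → Σℚ≡sum (f i)) ⟩
  Σℚ (λ i → sum (λ j → f i j))  ≡⟨ Σℚ≡sum (λ i → sum (f i)) ⟩
  sum (λ i → sum (λ j → f i j)) ≡⟨ ∑-comm f ⟩
  sum (λ j → sum (λ i → f i j)) ≡⟨ Σℚ≡sum (λ j → sum (λ i → f i j)) ⟨
  Σℚ (λ j → sum (λ i → f i j))  ≡⟨ Σℚ-cong (λ j → Σℚ≡sum (λ i → f i j)) ⟨
  Σℚ (λ j → Σℚ (λ i → f i j))   ∎
  where open ≡-Reasoning

Σℚ-neg : ∀ {k} (f : Fin k → ℚ) → Σℚ (λ j → - f j) ≡ - Σℚ f
Σℚ-neg {zero} f = refl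
Σℚ-neg {suc k} f =
  trans (cong (- f zero +_) (Σℚ-neg (f ∘ suc))) (sym (neg-distrib-+ (f zero) (Σℚ (f ∘ suc))))

Σℚ-distrib-minus : ∀ {k} (f g : Fin k → ℚ) → Σℚ (λ j → f j - g j) ≡ Σℚ f - Σℚ g
Σℚ-distrib-minus f g = trans (Σℚ-distrib-+ f (λ j → - g j)) (cong (Σℚ f +_) (Σℚ-neg g))

Σℚ-mono-≤ : ∀ {k} {f g : Fin k → ℚ} → (∀ j → f j ≤ g j) → Σℚ f ≤ Σℚ g
Σℚ-mono-≤ {zero} f≤g = ≤-refl
Σℚ-mono-≤ {suc k} f≤g = +-mono-≤ (f≤g zero) (Σℚ-mono-≤ (f≤g ∘ suc))

Σℚ-nonNeg : ∀ {k} {f : Fin k → ℚ} → (∀ j → 0ℚ ≤ f j) → 0ℚ ≤ Σℚ f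
Σℚ-nonNeg {k} {f} f≥0 = subst (_≤ Σℚ f) (Σℚ-zero {k} (λ _ → refl)) (Σℚ-mono-≤ f≥0)

Σℚ-nonPos : ∀ {k} {f : Fin k → ℚ} → (∀ j → f j ≤ 0ℚ) → Σℚ f ≤ 0ℚ
Σℚ-nonPos {k} {f} f≤0 = subst (Σℚ f ≤_) (Σℚ-zero {k} (λ _ → refl)) (Σℚ-mono-≤ f≤0)

Σℚ-nonNeg-≡0 : ∀ {k} {f : Fin k → ℚ} → (∀ j → 0ℚ ≤ f j) → Σℚ f ≡ 0ℚ → ∀ j → f j ≡ 0ℚ
Σℚ-nonNeg-≡0 {suc k} {f} f≥0 Σf≡0 zero = nonNeg+nonNeg≡0 (f≥0 zero) (Σℚ-nonNeg (f≥0 ∘ suc)) Σf≡0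
Σℚ-nonNeg-≡0 {suc k} {f} f≥0 Σf≡0 (suc j) = Σℚ-nonNeg-≡0 (f≥0 ∘ suc)
  (nonNeg+nonNeg≡0 (Σℚ-nonNeg (f≥0 ∘ suc)) (f≥0 zero) (trans (+-comm _ (f zero)) Σf≡0)) j

Σℚ-nonPos-≤ : ∀ {k} {f : Fin k → ℚ} → (∀ j → f j ≤ 0ℚ) → ∀ i → Σℚ f ≤ f i
Σℚ-nonPos-≤ {suc k} {f} f≤0 zero =
  subst (Σℚ f ≤_) (+-identityʳ (f zero)) (+-monoʳ-≤ (f zero) (Σℚ-nonPos (f≤0 ∘ suc)))
Σℚ-nonPos-≤ {suc k} {f} f≤0 (suc i) =
  subst (Σℚ f ≤_) (+-identityˡ (f (suc i))) (+-mono-≤ (f≤0 zero) (Σℚ-nonPos-≤ (f≤0 ∘ suc) i))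

Σℚ-single : ∀ {k} (f : Fin k → ℚ) (i : Fin k) → (∀ j → j ≢ i → f j ≡ 0ℚ) → Σℚ f ≡ f i
Σℚ-single {suc k} f zero f≡0 =
  trans (cong (f zero +_) (Σℚ-zero (λ j → f≡0 (suc j) λ ()))) (+-identityʳ (f zero))
Σℚ-single {suc k} f (suc i) f≡0 =
  trans (cong₂ _+_ (f≡0 zero λ ()) (Σℚ-single (f ∘ suc) i (λ j j≢i → f≡0 (suc j) (j≢i ∘ suc-injective))))
        (+-identityˡ (f (suc i)))

δ-refl : ∀ {k} (i : Fin k) → δ i i ≡ 1ℚ
δ-refl i with i ≟ᶠ i
... | yes _ = refl
... | no i≢i = ⊥-elim (i≢i refl)

δ-≢ : ∀ {k} {i j : Fin k} → i ≢ j → δ i j ≡ 0ℚ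
δ-≢ {i = i} {j} i≢j with i ≟ᶠ j
... | yes i≡j = ⊥-elim (i≢j i≡j)
... | no _ = refl

δ-nonNeg : ∀ {k} (i j : Fin k) → 0ℚ ≤ δ i j
δ-nonNeg i j with i ≟ᶠ j
... | yes _ = *≤* (ℤ.+≤+ z≤n)
... | no _ = ≤-refl

Σℚ-δ : ∀ {k} (i : Fin k) (f : Fin k → ℚ) → Σℚ (λ j → f j * δ i j) ≡ f i
Σℚ-δ i f = begin
  Σℚ (λ j → f j * δ i j)  ≡⟨ Σℚ-single _ i (λ j j≢i → trans (cong (f j *_) (δ-≢ (j≢i ∘ sym))) (*-zeroʳ (f j))) ⟩
  f i * δ i i             ≡⟨ cong (f i *_) (δ-refl i) ⟩
  f i * 1ℚ                ≡⟨ *-identityʳ (f i) ⟩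
  f i                     ∎
  where open ≡-Reasoning

flipAt : ∀ {d} → Fin d → Fin d → ℚ
flipAt i m = 1ℚ - (1ℚ + 1ℚ) * δ i m

flipAt-≡ : ∀ {d} (i : Fin d) → flipAt i i ≡ -1ℚ
flipAt-≡ i = cong (λ t → 1ℚ - (1ℚ + 1ℚ) * t) (δ-refl i)

flipAt-≢ : ∀ {d} {i m : Fin d} → i ≢ m → flipAt i m ≡ 1ℚ
flipAt-≢ i≢m = cong (λ t → 1ℚ - (1ℚ + 1ℚ) * t) (δ-≢ i≢m)

flipAt-sign : ∀ {d} (i m : Fin d) → IsSign (flipAt i m)
flipAt-sign i m = from-dec (i ≟ᶠ m)
  where
  from-dec : Dec (i ≡ m) → IsSign (flipAt i m)
  from-dec (yes refl) = inj₂ (flipAt-≡ i)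
  from-dec (no i≢m) = inj₁ (flipAt-≢ i≢m)

Σℚ-flipAt : ∀ {d} (i : Fin d) (f : Fin d → ℚ) → Σℚ (λ m → flipAt i m * f m) ≡ Σℚ f - (1ℚ + 1ℚ) * f i
Σℚ-flipAt i f = begin
  Σℚ (λ m → flipAt i m * f m)                         ≡⟨ Σℚ-cong (λ m → expand (δ i m) (f m)) ⟩
  Σℚ (λ m → f m - (1ℚ + 1ℚ) * (f m * δ i m))          ≡⟨ Σℚ-distrib-minus f (λ m → (1ℚ + 1ℚ) * (f m * δ i m)) ⟩
  Σℚ f - Σℚ (λ m → (1ℚ + 1ℚ) * (f m * δ i m))
    ≡⟨ cong (λ t → Σℚ f - t) (*-distribˡ-Σℚ (1ℚ + 1ℚ) (λ m → f m * δ i m)) ⟨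
  Σℚ f - (1ℚ + 1ℚ) * Σℚ (λ m → f m * δ i m)           ≡⟨ cong (λ t → Σℚ f - (1ℚ + 1ℚ) * t) (Σℚ-δ i f) ⟩
  Σℚ f - (1ℚ + 1ℚ) * f i                              ∎
  where
  open ≡-Reasoning
  expand : ∀ δ x → (1ℚ - (1ℚ + 1ℚ) * δ) * x ≡ x - (1ℚ + 1ℚ) * (x * δ)
  expand = solve-∀ ℚ-ring

argmin-over-positive : ∀ {k} (f r : Fin k → ℚ) →
  (∀ j → f j ≤ 0ℚ) ⊎ (∃ λ j → 0ℚ < f j × (∀ j′ → 0ℚ < f j′ → r j ≤ r j′))
argmin-over-positive {zero} f r = inj₁ λ ()
argmin-over-positive {suc k} f r with argmin-over-positive (f ∘ suc) (r ∘ suc) | 0ℚ <? f zero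
... | inj₁ tail≤0 | no f₀≯0 = inj₁ λ { zero → ≮⇒≥ f₀≯0 ; (suc j) → tail≤0 j }
... | inj₁ tail≤0 | yes f₀>0 = inj₂ (zero , f₀>0 , λ
  { zero _ → ≤-refl ; (suc j) fⱼ>0 → ⊥-elim (<-irrefl refl (<-≤-trans fⱼ>0 (tail≤0 j))) })
... | inj₂ (j , fⱼ>0 , min) | no f₀≯0 = inj₂ (suc j , fⱼ>0 , λ
  { zero f₀>0 → ⊥-elim (f₀≯0 f₀>0) ; (suc j′) fⱼ′>0 → min j′ fⱼ′>0 })
... | inj₂ (j , fⱼ>0 , min) | yes f₀>0 with r zero ≤? r (suc j)
...   | yes r₀≤ = inj₂ (zero , f₀>0 , λ { zero _ → ≤-refl ; (suc j′) fⱼ′>0 → ≤-trans r₀≤ (min j′ fⱼ′>0) })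
...   | no r₀≰ = inj₂ (suc j , fⱼ>0 , λ { zero _ → <⇒≤ (≰⇒> r₀≰) ; (suc j′) fⱼ′>0 → min j′ fⱼ′>0 })

-V_ : ∀ {d} → Vect d → Vect d
(-V x) i = - x i

-1ℚ·V≋-V : ∀ {d} (x : Vect d) → (-1ℚ ·V x) ≋ (-V x)
-1ℚ·V≋-V x k = -1*x≈-x (x k)

ΣV-coord : ∀ {k d} (f : Fin k → Vect d) (m : Fin d) → ΣV f m ≡ Σℚ (λ j → f j m)
ΣV-coord {zero} f m = refl
ΣV-coord {suc k} f m = cong (f zero m +_) (ΣV-coord (f ∘ suc) m)

⟨⟩-cong : ∀ {d} {x x' y y' : Vect d} → x ≋ x' → y ≋ y' → ⟨ x , y ⟩ ≡ ⟨ x' , y' ⟩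
⟨⟩-cong x≋x' y≋y' = Σℚ-cong (λ i → cong₂ _*_ (x≋x' i) (y≋y' i))

⟨⟩-congʳ : ∀ {d} (w : Vect d) {y y' : Vect d} → y ≋ y' → ⟨ w , y ⟩ ≡ ⟨ w , y' ⟩
⟨⟩-congʳ w = ⟨⟩-cong {x = w} (λ _ → refl)

⟨⟩-congˡ : ∀ {d} {w w' : Vect d} (y : Vect d) → w ≋ w' → ⟨ w , y ⟩ ≡ ⟨ w' , y ⟩
⟨⟩-congˡ y w≋w' = ⟨⟩-cong w≋w' (λ _ → refl)

⟨⟩-comm : ∀ {d} (x y : Vect d) → ⟨ x , y ⟩ ≡ ⟨ y , x ⟩
⟨⟩-comm x y = Σℚ-cong (λ i → *-comm (x i) (y i))

⟨⟩-zeroʳ : ∀ {d} (w : Vect d) → ⟨ w , zeroV ⟩ ≡ 0ℚ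
⟨⟩-zeroʳ w = Σℚ-zero (λ i → *-zeroʳ (w i))

⟨⟩-+ʳ : ∀ {d} (w x y : Vect d) → ⟨ w , x +V y ⟩ ≡ ⟨ w , x ⟩ + ⟨ w , y ⟩
⟨⟩-+ʳ w x y = trans (Σℚ-cong (λ i → *-distribˡ-+ (w i) (x i) (y i))) (Σℚ-distrib-+ (λ i → w i * x i) (λ i → w i * y i))

⟨⟩-*ʳ : ∀ {d} (w : Vect d) (t : ℚ) (x : Vect d) → ⟨ w , t ·V x ⟩ ≡ t * ⟨ w , x ⟩
⟨⟩-*ʳ w t x = trans (Σℚ-cong (λ i → x*[t*y]≡t*[x*y] (w i) (x i))) (sym (*-distribˡ-Σℚ t (λ i → w i * x i)))
  where
  x*[t*y]≡t*[x*y] : ∀ a b → a * (t * b) ≡ t * (a * b)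
  x*[t*y]≡t*[x*y] a b = solve (a ∷ b ∷ t ∷ []) ℚ-ring

⟨⟩-negʳ : ∀ {d} (w x : Vect d) → ⟨ w , -V x ⟩ ≡ - ⟨ w , x ⟩
⟨⟩-negʳ w x = trans (Σℚ-cong (λ i → sym (neg-distribʳ-* (w i) (x i)))) (Σℚ-neg (λ i → w i * x i))

⟨⟩-+ˡ : ∀ {d} (w x y : Vect d) → ⟨ w +V x , y ⟩ ≡ ⟨ w , y ⟩ + ⟨ x , y ⟩
⟨⟩-+ˡ w x y = trans (⟨⟩-comm (w +V x) y) (trans (⟨⟩-+ʳ y w x) (cong₂ _+_ (⟨⟩-comm y w) (⟨⟩-comm y x)))

⟨⟩-*ˡ : ∀ {d} (t : ℚ) (w x : Vect d) → ⟨ t ·V w , x ⟩ ≡ t * ⟨ w , x ⟩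
⟨⟩-*ˡ t w x = trans (⟨⟩-comm (t ·V w) x) (trans (⟨⟩-*ʳ x t w) (cong (t *_) (⟨⟩-comm x w)))

⟨⟩-negˡ : ∀ {d} (w x : Vect d) → ⟨ -V w , x ⟩ ≡ - ⟨ w , x ⟩
⟨⟩-negˡ w x = trans (⟨⟩-comm (-V w) x) (trans (⟨⟩-negʳ x w) (cong -_ (⟨⟩-comm x w)))

⟨⟩-ΣVʳ : ∀ {k d} (w : Vect d) (c : Fin k → ℚ) (p : Fin k → Vect d) →
  ⟨ w , ΣV (λ j → c j ·V p j) ⟩ ≡ Σℚ (λ j → c j * ⟨ w , p j ⟩)
⟨⟩-ΣVʳ w c p = begin
  Σℚ (λ i → w i * ΣV (λ j → c j ·V p j) i)   ≡⟨ Σℚ-cong (λ i → cong (w i *_) (ΣV-coord (λ j → c j ·V p j) i)) ⟩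
  Σℚ (λ i → w i * Σℚ (λ j → c j * p j i))   ≡⟨ Σℚ-cong (λ i → *-distribˡ-Σℚ (w i) (λ j → c j * p j i)) ⟩
  Σℚ (λ i → Σℚ (λ j → w i * (c j * p j i))) ≡⟨ Σℚ-comm (λ i j → w i * (c j * p j i)) ⟩
  Σℚ (λ j → Σℚ (λ i → w i * (c j * p j i))) ≡⟨ Σℚ-cong (λ j → ⟨⟩-*ʳ w (c j) (p j)) ⟩
  Σℚ (λ j → c j * ⟨ w , p j ⟩)               ∎
  where open ≡-Reasoning

⟨⟩-convexʳ : ∀ {d} (w a b : Vect d) (t : ℚ) →
  ⟨ w , (t ·V a) +V ((1ℚ - t) ·V b) ⟩ ≡ t * ⟨ w , a ⟩ + (1ℚ - t) * ⟨ w , b ⟩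
⟨⟩-convexʳ w a b t = trans (⟨⟩-+ʳ w (t ·V a) ((1ℚ - t) ·V b)) (cong₂ _+_ (⟨⟩-*ʳ w t a) (⟨⟩-*ʳ w (1ℚ - t) b))

⟨⟩-convexˡ : ∀ {d} (a b y : Vect d) (t : ℚ) →
  ⟨ (t ·V a) +V ((1ℚ - t) ·V b) , y ⟩ ≡ t * ⟨ a , y ⟩ + (1ℚ - t) * ⟨ b , y ⟩
⟨⟩-convexˡ a b y t = trans (⟨⟩-+ˡ (t ·V a) ((1ℚ - t) ·V b) y) (cong₂ _+_ (⟨⟩-*ˡ t a y) (⟨⟩-*ˡ (1ℚ - t) b y))

nonZero-if-tight : ∀ {d} {x y : Vect d} → ⟨ x , y ⟩ ≡ -1ℚ → ∃ λ i → x i ≢ 0ℚ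
nonZero-if-tight {d} {x} {y} tight = ¬∀⟶∃¬ d (λ i → x i ≡ 0ℚ) (λ i → x i ≟ 0ℚ) λ x≡0 →
  -1≢0 (trans (sym tight) (Σℚ-zero (λ i → trans (cong (_* y i) (x≡0 i)) (*-zeroˡ (y i)))))

-- Linear algebra

HasNontrivialSolution : ∀ {m n} → (Fin m → Fin n → ℚ) → Set
HasNontrivialSolution {n = n} A = Σ (Fin n → ℚ) λ c →
  (∃ λ j → c j ≢ 0ℚ) × (∀ r → Σℚ (λ j → A r j * c j) ≡ 0ℚ)

*-nonZero : ∀ {a b} → a ≢ 0ℚ → b ≢ 0ℚ → a * b ≢ 0ℚ
*-nonZero a≢0 b≢0 ab≡0 = b≢0 (*-eq-zero a≢0 ab≡0)

zero-column-solution : ∀ {m n} (A : Fin m → Fin (suc n) → ℚ) →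
  (∀ r → A r zero ≡ 0ℚ) → HasNontrivialSolution A
zero-column-solution {n = n} A column≡0 =
  δ zero , (zero , λ δ≡0 → 1≢0 (trans (sym (δ-refl {suc n} zero)) δ≡0)) ,
  λ r → trans (Σℚ-δ zero (A r)) (column≡0 r)

eliminated-row : ∀ {n} (A : Fin (suc n) → ℚ) (pivot : Fin (suc n) → ℚ) → Fin n → ℚ
eliminated-row A pivot j = pivot zero * A (suc j) - A zero * pivot (suc j)

back-substitute : ∀ {n} (pivot : Fin (suc n) → ℚ) (c′ : Fin n → ℚ) → Fin (suc n) → ℚ
back-substitute pivot c′ zero = - Σℚ (λ j → pivot (suc j) * c′ j)
back-substitute pivot c′ (suc j) = pivot zero * c′ j

back-substitute-row : ∀ {n} (A pivot : Fin (suc n) → ℚ) (c′ : Fin n → ℚ) →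
  Σℚ (λ j → A j * back-substitute pivot c′ j) ≡ Σℚ (λ j → eliminated-row A pivot j * c′ j)
back-substitute-row A pivot c′ = begin
  A zero * - S pivot + Σℚ (λ j → A (suc j) * (a * c′ j))
    ≡⟨ cong (A zero * - S pivot +_) (Σℚ-cong (λ j → x*[a*y]≡a*[x*y] (A (suc j)) a (c′ j))) ⟩
  A zero * - S pivot + Σℚ (λ j → a * (A (suc j) * c′ j))
    ≡⟨ cong (A zero * - S pivot +_) (*-distribˡ-Σℚ a (λ j → A (suc j) * c′ j)) ⟨
  A zero * - S pivot + a * S A
    ≡⟨ rearrange (A zero) (S pivot) (a * S A) ⟩
  a * S A - A zero * S pivot
    ≡⟨ cong₂ _-_ (*-distribˡ-Σℚ a (λ j → A (suc j) * c′ j)) (*-distribˡ-Σℚ (A zero) (λ j → pivot (suc j) * c′ j)) ⟩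
  Σℚ (λ j → a * (A (suc j) * c′ j)) - Σℚ (λ j → A zero * (pivot (suc j) * c′ j))
    ≡⟨ Σℚ-distrib-minus (λ j → a * (A (suc j) * c′ j)) (λ j → A zero * (pivot (suc j) * c′ j)) ⟨
  Σℚ (λ j → a * (A (suc j) * c′ j) - A zero * (pivot (suc j) * c′ j))
    ≡⟨ Σℚ-cong (λ j → distribute a (A (suc j)) (A zero) (pivot (suc j)) (c′ j)) ⟨
  Σℚ (λ j → eliminated-row A pivot j * c′ j) ∎
  where
  open ≡-Reasoning
  a : ℚ
  a = pivot zero
  S : (Fin (suc _) → ℚ) → ℚ
  S B = Σℚ (λ j → B (suc j) * c′ j)
  x*[a*y]≡a*[x*y] : ∀ x a y → x * (a * y) ≡ a * (x * y)
  x*[a*y]≡a*[x*y] = solve-∀ ℚ-ring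
  rearrange : ∀ x s y → x * - s + y ≡ y - x * s
  rearrange = solve-∀ ℚ-ring
  distribute : ∀ a x y z w → (a * x - y * z) * w ≡ a * (x * w) - y * (z * w)
  distribute = solve-∀ ℚ-ring

eliminate-first-unknown : ∀ {m n} (A : Fin (suc m) → Fin (suc n) → ℚ) (p : Fin (suc m)) →
  A p zero ≢ 0ℚ → HasNontrivialSolution (λ s → eliminated-row (A (punchIn p s)) (A p)) →
  HasNontrivialSolution A
eliminate-first-unknown A p a≢0 (c′ , (j₀ , c′j₀≢0) , reduced≡0) =
  back-substitute (A p) c′ , (suc j₀ , *-nonZero a≢0 c′j₀≢0) , λ r → trans (back-substitute-row (A r) (A p) c′) (rows r)
  where
  rows : ∀ r → Σℚ (λ j → eliminated-row (A r) (A p) j * c′ j) ≡ 0ℚ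
  rows r with p ≟ᶠ r
  ... | yes refl = Σℚ-zero λ j → trans (cong (_* c′ j) (+-inverseʳ (A p zero * A p (suc j)))) (*-zeroˡ (c′ j))
  ... | no p≢r = subst (λ r′ → Σℚ (λ j → eliminated-row (A r′) (A p) j * c′ j) ≡ 0ℚ)
                       (punchIn-punchOut p≢r) (reduced≡0 (punchOut p≢r))

fewer-equations-nontrivial : ∀ {m n} → m <ℕ n → (A : Fin m → Fin n → ℚ) → HasNontrivialSolution A
fewer-equations-nontrivial {zero} {suc n} _ A = zero-column-solution A (λ ())
fewer-equations-nontrivial {suc m} {suc (suc n)} (s≤s m<n) A with all? (λ r → A r zero ≟ 0ℚ)
... | yes column≡0 = zero-column-solution A column≡0
... | no column≢0 with ¬∀⟶∃¬ _ (λ r → A r zero ≡ 0ℚ) (λ r → A r zero ≟ 0ℚ) column≢0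
...   | p , a≢0 = eliminate-first-unknown A p a≢0
            (fewer-equations-nontrivial m<n (λ s → eliminated-row (A (punchIn p s)) (A p)))

zero-row-nontrivial : ∀ {n} (A : Fin n → Fin n → ℚ) (i : Fin n) → (∀ j → A i j ≡ 0ℚ) →
  HasNontrivialSolution A
zero-row-nontrivial {suc n} A i row-i≡0 with fewer-equations-nontrivial (n<1+n n) (A ∘ punchIn i)
... | c , nontrivial , rows≡0 = c , nontrivial , rows
  where
  rows : ∀ r → Σℚ (λ j → A r j * c j) ≡ 0ℚ
  rows r with i ≟ᶠ r
  ... | yes refl = Σℚ-zero (λ j → trans (cong (_* c j) (row-i≡0 j)) (*-zeroˡ (c j)))
  ... | no i≢r = subst (λ r′ → Σℚ (λ j → A r′ j * c j) ≡ 0ℚ) (punchIn-punchOut i≢r) (rows≡0 (punchOut i≢r))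

module Basis {d} (e e* : Fin d → Vect d) (dual : ∀ i j → ⟨ e* i , e j ⟩ ≡ δ i j) where

  coord : Fin d → Vect d → ℚ
  coord i x = ⟨ e* i , x ⟩

  coord-ΣV : ∀ {k} i (c : Fin k → ℚ) (p : Fin k → Vect d) →
    coord i (ΣV (λ j → c j ·V p j)) ≡ Σℚ (λ j → c j * coord i (p j))
  coord-ΣV i = ⟨⟩-ΣVʳ (e* i)

  coord-combination : ∀ i (c : Fin d → ℚ) → coord i (ΣV (λ j → c j ·V e j)) ≡ c i
  coord-combination i c =
    trans (coord-ΣV i c e) (trans (Σℚ-cong (λ j → cong (c j *_) (dual i j))) (Σℚ-δ i c))

  private
    augmented : Vect d → Fin d → Fin (suc d) → ℚ
    augmented x k zero = x k
    augmented x k (suc l) = e l k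

    relation-coefficients : ∀ x (c : Fin (suc d) → ℚ) →
      (∀ k → Σℚ (λ j → augmented x k j * c j) ≡ 0ℚ) → ∀ m → c (suc m) ≡ - (c zero * coord m x)
    relation-coefficients x c rows≡0 m = sym (p-q≡0⇒p≡q _ _ (begin
      - (c zero * coord m x) - c (suc m)  ≡⟨ solve-∀-neg (c zero * coord m x) (c (suc m)) ⟩
      - (c zero * coord m x + c (suc m))  ≡⟨ cong (λ t → - (t + c (suc m))) (⟨⟩-*ʳ (e* m) (c zero) x) ⟨
      - (coord m z₁ + c (suc m))          ≡⟨ cong (λ t → - (coord m z₁ + t)) (coord-combination m (c ∘ suc)) ⟨
      - (coord m z₁ + coord m z₂)         ≡⟨ cong -_ (⟨⟩-+ʳ (e* m) z₁ z₂) ⟨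
      - coord m (z₁ +V z₂)                ≡⟨ cong -_ (⟨⟩-congʳ (e* m) z≋0) ⟩
      - coord m zeroV                     ≡⟨ cong -_ (⟨⟩-zeroʳ (e* m)) ⟩
      0ℚ                                  ∎))
      where
      open ≡-Reasoning
      solve-∀-neg : ∀ a b → - a - b ≡ - (a + b)
      solve-∀-neg = solve-∀ ℚ-ring
      z₁ z₂ : Vect d
      z₁ = c zero ·V x
      z₂ = ΣV (λ l → c (suc l) ·V e l)
      z≋0 : (z₁ +V z₂) ≋ zeroV
      z≋0 k = begin
        c zero * x k + z₂ k                          ≡⟨ cong (c zero * x k +_) (ΣV-coord (λ l → c (suc l) ·V e l) k) ⟩
        c zero * x k + Σℚ (λ l → c (suc l) * e l k)
          ≡⟨ cong₂ _+_ (*-comm (c zero) (x k)) (Σℚ-cong (λ l → *-comm (c (suc l)) (e l k))) ⟩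
        x k * c zero + Σℚ (λ l → e l k * c (suc l)) ≡⟨ rows≡0 k ⟩
        0ℚ                                           ∎

  expansion : ∀ x → x ≋ ΣV (λ l → coord l x ·V e l)
  expansion x with fewer-equations-nontrivial (n<1+n d) (augmented x)
  ... | c , (j , cj≢0) , rows≡0 = λ k → p-q≡0⇒p≡q _ _ (*-eq-zero c₀≢0 (main k))
    where
    open ≡-Reasoning
    c′≡ : ∀ m → c (suc m) ≡ - (c zero * coord m x)
    c′≡ = relation-coefficients x c rows≡0

    c≡0 : c zero ≡ 0ℚ → ∀ j → c j ≡ 0ℚ
    c≡0 c₀≡0 zero = c₀≡0
    c≡0 c₀≡0 (suc m) = trans (c′≡ m) (trans (cong (λ t → - (t * coord m x)) c₀≡0) (cong -_ (*-zeroˡ (coord m x))))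

    c₀≢0 : c zero ≢ 0ℚ
    c₀≢0 c₀≡0 = cj≢0 (c≡0 c₀≡0 j)

    main : ∀ k → c zero * (x k - ΣV (λ l → coord l x ·V e l) k) ≡ 0ℚ
    main k = begin
      c zero * (x k - ΣV (λ l → coord l x ·V e l) k)
        ≡⟨ cong (λ t → c zero * (x k - t)) (ΣV-coord (λ l → coord l x ·V e l) k) ⟩
      c zero * (x k - Σℚ (λ l → coord l x * e l k))
        ≡⟨ split (c zero) (x k) (Σℚ (λ l → coord l x * e l k)) ⟩
      x k * c zero + - (c zero * Σℚ (λ l → coord l x * e l k))
        ≡⟨ cong (λ t → x k * c zero + - t) (*-distribˡ-Σℚ (c zero) (λ l → coord l x * e l k)) ⟩
      x k * c zero + - Σℚ (λ l → c zero * (coord l x * e l k))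
        ≡⟨ cong (x k * c zero +_) (Σℚ-neg (λ l → c zero * (coord l x * e l k))) ⟨
      x k * c zero + Σℚ (λ l → - (c zero * (coord l x * e l k)))
        ≡⟨ cong (x k * c zero +_) (Σℚ-cong (λ l → trans (regroup (c zero) (coord l x) (e l k))
                                                        (cong (e l k *_) (sym (c′≡ l))))) ⟩
      x k * c zero + Σℚ (λ l → e l k * c (suc l))
        ≡⟨ rows≡0 k ⟩
      0ℚ ∎
      where
      split : ∀ a b s → a * (b - s) ≡ b * a + - (a * s)
      split = solve-∀ ℚ-ring
      regroup : ∀ a b y → - (a * (b * y)) ≡ y * - (a * b)
      regroup = solve-∀ ℚ-ring

  ¬ConvExcept-self : ∀ i → ¬ ConvExcept e i (e i)
  ¬ConvExcept-self i (c , _ , cᵢ≡0 , _ , eᵢ≋) = 1≢0 (begin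
    1ℚ                               ≡⟨ δ-refl i ⟨
    δ i i                            ≡⟨ dual i i ⟨
    coord i (e i)                    ≡⟨ ⟨⟩-congʳ (e* i) eᵢ≋ ⟩
    coord i (ΣV (λ j → c j ·V e j))  ≡⟨ coord-combination i c ⟩
    c i                              ≡⟨ cᵢ≡0 ⟩
    0ℚ                               ∎)
    where open ≡-Reasoning

  ⟨⟩-expand : ∀ w x → ⟨ w , x ⟩ ≡ Σℚ (λ l → coord l x * ⟨ w , e l ⟩)
  ⟨⟩-expand w x = trans (⟨⟩-congʳ w (expansion x)) (⟨⟩-ΣVʳ w (λ l → coord l x) e)

  coord-ext : ∀ {x y} → (∀ l → coord l x ≡ coord l y) → x ≋ y
  coord-ext {x} {y} coords≡ k = begin
    x k                                    ≡⟨ expansion x k ⟩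
    ΣV (λ l → coord l x ·V e l) k          ≡⟨ ΣV-coord (λ l → coord l x ·V e l) k ⟩
    Σℚ (λ l → coord l x * e l k)           ≡⟨ Σℚ-cong (λ l → cong (_* e l k) (coords≡ l)) ⟩
    Σℚ (λ l → coord l y * e l k)           ≡⟨ ΣV-coord (λ l → coord l y ·V e l) k ⟨
    ΣV (λ l → coord l y ·V e l) k          ≡⟨ expansion y k ⟨
    y k                                    ∎
    where open ≡-Reasoning

  dual-ext : ∀ {w w′} → (∀ l → ⟨ w , e l ⟩ ≡ ⟨ w′ , e l ⟩) → w ≋ w′
  dual-ext {w} {w′} values≡ m = begin
    w m                                        ≡⟨ Σℚ-δ m w ⟨
    ⟨ w , δ m ⟩                                ≡⟨ ⟨⟩-expand w (δ m) ⟩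
    Σℚ (λ l → coord l (δ m) * ⟨ w , e l ⟩)     ≡⟨ Σℚ-cong (λ l → cong (coord l (δ m) *_) (values≡ l)) ⟩
    Σℚ (λ l → coord l (δ m) * ⟨ w′ , e l ⟩)    ≡⟨ ⟨⟩-expand w′ (δ m) ⟨
    ⟨ w′ , δ m ⟩                               ≡⟨ Σℚ-δ m w′ ⟩
    w′ m                                       ∎
    where open ≡-Reasoning

  dual-ext-except : ∀ i {p w w′} → coord i p ≢ 0ℚ →
    (∀ m → m ≢ i → ⟨ w , e m ⟩ ≡ ⟨ w′ , e m ⟩) → ⟨ w , p ⟩ ≡ ⟨ w′ , p ⟩ → w ≋ w′
  dual-ext-except i {p} {w} {w′} pᵢ≢0 values≡ at-p≡ = dual-ext values≡′
    where
    open ≡-Reasoning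
    term : Vect d → Fin d → ℚ
    term v l = coord l p * ⟨ v , e l ⟩

    at-i : coord i p * (⟨ w , e i ⟩ - ⟨ w′ , e i ⟩) ≡ 0ℚ
    at-i = begin
      coord i p * (⟨ w , e i ⟩ - ⟨ w′ , e i ⟩)  ≡⟨ *-distribˡ-minus (coord i p) (⟨ w , e i ⟩) (⟨ w′ , e i ⟩) ⟩
      term w i - term w′ i                      ≡⟨ Σℚ-single (λ l → term w l - term w′ l) i off-i ⟨
      Σℚ (λ l → term w l - term w′ l)           ≡⟨ Σℚ-distrib-minus (term w) (term w′) ⟩
      Σℚ (term w) - Σℚ (term w′)                ≡⟨ cong₂ _-_ (⟨⟩-expand w p) (⟨⟩-expand w′ p) ⟨
      ⟨ w , p ⟩ - ⟨ w′ , p ⟩                    ≡⟨ cong (_- ⟨ w′ , p ⟩) at-p≡ ⟩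
      ⟨ w′ , p ⟩ - ⟨ w′ , p ⟩                   ≡⟨ +-inverseʳ (⟨ w′ , p ⟩) ⟩
      0ℚ                                        ∎
      where
      *-distribˡ-minus : ∀ a b c → a * (b - c) ≡ a * b - a * c
      *-distribˡ-minus = solve-∀ ℚ-ring
      off-i : ∀ l → l ≢ i → term w l - term w′ l ≡ 0ℚ
      off-i l l≢i = trans (cong (λ t → term w l - coord l p * t) (sym (values≡ l l≢i)))
                          (+-inverseʳ (term w l))

    values≡′ : ∀ l → ⟨ w , e l ⟩ ≡ ⟨ w′ , e l ⟩
    values≡′ l with l ≟ᶠ i
    ... | yes refl = p-q≡0⇒p≡q _ _ (*-eq-zero pᵢ≢0 at-i)
    ... | no l≢i = values≡ l l≢i

  coord-signed-e : ∀ s j m → coord j (s ·V e m) ≡ s * δ j m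
  coord-signed-e s j m = trans (⟨⟩-*ʳ (e* j) s (e m)) (cong (s *_) (dual j m))

  signed-basis-affInd : (σ : Fin d → ℚ) → (∀ m → IsSign (σ m)) → AffInd (λ m → σ m ·V e m)
  signed-basis-affInd σ σ-sign c _ combination≋0 j = *-eq-zero (IsSign⇒≢0 (σ-sign j)) (begin
    σ j * c j                                         ≡⟨ *-comm (σ j) (c j) ⟩
    c j * σ j                                         ≡⟨ Σℚ-δ j (λ m → c m * σ m) ⟨
    Σℚ (λ m → c m * σ m * δ j m)
      ≡⟨ Σℚ-cong (λ m → trans (*-assoc (c m) (σ m) (δ j m)) (cong (c m *_) (sym (coord-signed-e (σ m) j m)))) ⟩
    Σℚ (λ m → c m * coord j (σ m ·V e m))             ≡⟨ coord-ΣV j c (λ m → σ m ·V e m) ⟨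
    coord j (ΣV (λ m → c m ·V (σ m ·V e m)))          ≡⟨ ⟨⟩-congʳ (e* j) combination≋0 ⟩
    coord j zeroV                                     ≡⟨ ⟨⟩-zeroʳ (e* j) ⟩
    0ℚ                                                ∎)
    where open ≡-Reasoning

  signed-basis-injective : (σ : Fin d → ℚ) → (∀ m → IsSign (σ m)) →
    ∀ m m′ → (σ m ·V e m) ≋ (σ m′ ·V e m′) → m ≡ m′
  signed-basis-injective σ σ-sign m m′ σe≋σ′e′ = by-dec (m ≟ᶠ m′)
    where
    by-dec : Dec (m ≡ m′) → m ≡ m′
    by-dec (yes m≡m′) = m≡m′
    by-dec (no m≢m′) = ⊥-elim (IsSign⇒≢0 (σ-sign m) (begin
      σ m                      ≡⟨ *-identityʳ (σ m) ⟨
      σ m * 1ℚ                 ≡⟨ cong (σ m *_) (δ-refl m) ⟨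
      σ m * δ m m              ≡⟨ coord-signed-e (σ m) m m ⟨
      coord m (σ m ·V e m)     ≡⟨ ⟨⟩-congʳ (e* m) σe≋σ′e′ ⟩
      coord m (σ m′ ·V e m′)   ≡⟨ coord-signed-e (σ m′) m m′ ⟩
      σ m′ * δ m m′            ≡⟨ cong (σ m′ *_) (δ-≢ m≢m′) ⟩
      σ m′ * 0ℚ                ≡⟨ *-zeroʳ (σ m′) ⟩
      0ℚ                       ∎))
      where open ≡-Reasoning

-- Convex hulls and extreme points

Extreme : ∀ {d} → Pred (Vect d) 0ℓ → Vect d → Set
Extreme S x = ∀ a b t → S a → S b → 0ℚ < t → t < 1ℚ →
  x ≋ ((t ·V a) +V ((1ℚ - t) ·V b)) → a ≋ b

Extreme-anti-⊆ : ∀ {d} {S T : Pred (Vect d) 0ℓ} {x} → (∀ y → T y → S y) → Extreme S x → Extreme T x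
Extreme-anti-⊆ T⊆S extreme a b t a∈T b∈T = extreme a b t (T⊆S a a∈T) (T⊆S b b∈T)

Extreme-resp-≋ : ∀ {d} {S : Pred (Vect d) 0ℓ} {x x′} → x ≋ x′ → Extreme S x → Extreme S x′
Extreme-resp-≋ x≋x′ extreme a b t a∈S b∈S 0<t t<1 x′≋ =
  extreme a b t a∈S b∈S 0<t t<1 (λ i → trans (x≋x′ i) (x′≋ i))

Conv-resp-≋ : ∀ {k d} {p : Fin k → Vect d} {y y′} → Conv p y → y ≋ y′ → Conv p y′
Conv-resp-≋ (c , c≥0 , Σc≡1 , y≋) y≋y′ = c , c≥0 , Σc≡1 , λ i → trans (sym (y≋y′ i)) (y≋ i)

IsVertex-resp-≋ : ∀ {k d} {p : Fin k → Vect d} {x x′} → IsVertex (Conv p) x → x ≋ x′ → IsVertex (Conv p) x′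
IsVertex-resp-≋ (x∈ , extreme) x≋x′ = Conv-resp-≋ x∈ x≋x′ , Extreme-resp-≋ x≋x′ extreme

Σℚ-δ-single : ∀ {k} (j : Fin k) → Σℚ (δ j) ≡ 1ℚ
Σℚ-δ-single j = trans (Σℚ-single (δ j) j (λ l l≢j → δ-≢ (l≢j ∘ sym))) (δ-refl j)

Conv-member : ∀ {k d} (p : Fin k → Vect d) (j : Fin k) → Conv p (p j)
Conv-member p j = δ j , δ-nonNeg j , Σℚ-δ-single j , λ i → begin
  p j i                         ≡⟨ Σℚ-δ j (λ l → p l i) ⟨
  Σℚ (λ l → p l i * δ j l)      ≡⟨ Σℚ-cong (λ l → *-comm (p l i) (δ j l)) ⟩
  Σℚ (λ l → δ j l * p l i)      ≡⟨ ΣV-coord (λ l → δ j l ·V p l) i ⟨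
  ΣV (λ l → δ j l ·V p l) i     ∎
  where open ≡-Reasoning

ConvExcept-member : ∀ {k d} (p : Fin k → Vect d) {i j : Fin k} → j ≢ i → ConvExcept p i (p j)
ConvExcept-member p {j = j} j≢i =
  δ j , δ-nonNeg j , δ-≢ j≢i , Σℚ-δ-single j , proj₂ (proj₂ (proj₂ (Conv-member p j)))

Conv-tail : ∀ {k d} {p : Fin (suc k) → Vect d} {y} → Conv (p ∘ suc) y → Conv p y
Conv-tail {p = p} (c , c≥0 , Σc≡1 , y≋) = c′ , c′≥0 , trans (+-identityˡ (Σℚ c)) Σc≡1 ,
  λ i → trans (y≋ i) (sym (trans (cong (_+ rest i) (*-zeroˡ (p zero i))) (+-identityˡ (rest i))))
  where
  rest : Vect _
  rest = ΣV (λ j → c j ·V p (suc j))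
  c′ : Fin (suc _) → ℚ
  c′ zero = 0ℚ
  c′ (suc j) = c j
  c′≥0 : ∀ j → 0ℚ ≤ c′ j
  c′≥0 zero = ≤-refl
  c′≥0 (suc j) = c≥0 j

Σℚ-const : ∀ {k} (c : Fin k → ℚ) (m : ℚ) → Σℚ c ≡ 1ℚ → Σℚ (λ j → c j * m) ≡ m
Σℚ-const c m Σc≡1 = begin
  Σℚ (λ j → c j * m)  ≡⟨ Σℚ-cong (λ j → *-comm (c j) m) ⟩
  Σℚ (λ j → m * c j)  ≡⟨ *-distribˡ-Σℚ m c ⟨
  m * Σℚ c            ≡⟨ cong (m *_) Σc≡1 ⟩
  m * 1ℚ              ≡⟨ *-identityʳ m ⟩
  m                   ∎
  where open ≡-Reasoning

Conv-lowerBound : ∀ {k d} {p : Fin k → Vect d} (x : Vect d) (m : ℚ) →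
  (∀ j → m ≤ ⟨ x , p j ⟩) → ∀ {y} → Conv p y → m ≤ ⟨ x , y ⟩
Conv-lowerBound {p = p} x m m≤ {y} (c , c≥0 , Σc≡1 , y≋) = begin
  m                              ≡⟨ Σℚ-const c m Σc≡1 ⟨
  Σℚ (λ j → c j * m)             ≤⟨ Σℚ-mono-≤ (λ j → *-monoˡ-≤-nonNeg (c j) {{nonNegative (c≥0 j)}} (m≤ j)) ⟩
  Σℚ (λ j → c j * ⟨ x , p j ⟩)   ≡⟨ ⟨⟩-ΣVʳ x c p ⟨
  ⟨ x , ΣV (λ j → c j ·V p j) ⟩  ≡⟨ ⟨⟩-congʳ x y≋ ⟨
  ⟨ x , y ⟩                      ∎
  where open ≤-Reasoning

Conv-upperBound : ∀ {k d} {p : Fin k → Vect d} (x : Vect d) (m : ℚ) →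
  (∀ j → ⟨ x , p j ⟩ ≤ m) → ∀ {y} → Conv p y → ⟨ x , y ⟩ ≤ m
Conv-upperBound {p = p} x m ≤m {y} (c , c≥0 , Σc≡1 , y≋) = begin
  ⟨ x , y ⟩                      ≡⟨ ⟨⟩-congʳ x y≋ ⟩
  ⟨ x , ΣV (λ j → c j ·V p j) ⟩  ≡⟨ ⟨⟩-ΣVʳ x c p ⟩
  Σℚ (λ j → c j * ⟨ x , p j ⟩)   ≤⟨ Σℚ-mono-≤ (λ j → *-monoˡ-≤-nonNeg (c j) {{nonNegative (c≥0 j)}} (≤m j)) ⟩
  Σℚ (λ j → c j * m)             ≡⟨ Σℚ-const c m Σc≡1 ⟩
  m                              ∎
  where open ≤-Reasoning

Conv-weight-one : ∀ {k d} {p : Fin (suc k) → Vect d} {x} ((c , _) : Conv p x) → c zero ≡ 1ℚ → x ≋ p zero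
Conv-weight-one {p = p} {x} (c , c≥0 , Σc≡1 , x≋) c₀≡1 i = begin
  x i                                                  ≡⟨ x≋ i ⟩
  c zero * p zero i + ΣV (λ j → c (suc j) ·V p (suc j)) i
    ≡⟨ cong₂ _+_ (cong (_* p zero i) c₀≡1) (ΣV-coord (λ j → c (suc j) ·V p (suc j)) i) ⟩
  1ℚ * p zero i + Σℚ (λ j → c (suc j) * p (suc j) i)
    ≡⟨ cong (1ℚ * p zero i +_) (Σℚ-zero (λ j → trans (cong (_* p (suc j) i) (rest≡0 j)) (*-zeroˡ (p (suc j) i)))) ⟩
  1ℚ * p zero i + 0ℚ                                   ≡⟨ trans (+-identityʳ _) (*-identityˡ (p zero i)) ⟩
  p zero i                                             ∎
  where
  open ≡-Reasoning
  Σrest≡0 : Σℚ (c ∘ suc) ≡ 0ℚ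
  Σrest≡0 = begin
    Σℚ (c ∘ suc)                     ≡⟨ +-identityˡ (Σℚ (c ∘ suc)) ⟨
    0ℚ + Σℚ (c ∘ suc)                ≡⟨ cong (_+ Σℚ (c ∘ suc)) (+-inverseʳ 1ℚ) ⟨
    1ℚ - 1ℚ + Σℚ (c ∘ suc)           ≡⟨ cong (λ t → t - 1ℚ + Σℚ (c ∘ suc)) c₀≡1 ⟨
    c zero - 1ℚ + Σℚ (c ∘ suc)       ≡⟨ swap (c zero) (Σℚ (c ∘ suc)) ⟩
    c zero + Σℚ (c ∘ suc) - 1ℚ       ≡⟨ cong (_- 1ℚ) Σc≡1 ⟩
    1ℚ - 1ℚ                          ≡⟨ +-inverseʳ 1ℚ ⟩
    0ℚ                               ∎
    where
    swap : ∀ a b → a - 1ℚ + b ≡ a + b - 1ℚ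
    swap = solve-∀ ℚ-ring
  rest≡0 : ∀ j → c (suc j) ≡ 0ℚ
  rest≡0 = Σℚ-nonNeg-≡0 (c≥0 ∘ suc) Σrest≡0

ΣV-rescale : ∀ {k d} {s : ℚ} → s ≢ 0ℚ → (c : Fin k → ℚ) (p : Fin k → Vect d) (i : Fin d) →
  s * ΣV (λ j → (c j * s ⁻¹) ·V p j) i ≡ ΣV (λ j → c j ·V p j) i
ΣV-rescale {s = s} s≢0 c p i = begin
  s * ΣV (λ j → (c j * s ⁻¹) ·V p j) i        ≡⟨ cong (s *_) (ΣV-coord (λ j → (c j * s ⁻¹) ·V p j) i) ⟩
  s * Σℚ (λ j → c j * s ⁻¹ * p j i)           ≡⟨ *-distribˡ-Σℚ s (λ j → c j * s ⁻¹ * p j i) ⟩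
  Σℚ (λ j → s * (c j * s ⁻¹ * p j i))         ≡⟨ Σℚ-cong (λ j → regroup s (c j) (s ⁻¹) (p j i)) ⟩
  Σℚ (λ j → s ⁻¹ * s * (c j * p j i))         ≡⟨ Σℚ-cong (λ j → cong (_* (c j * p j i)) (⁻¹-inverseˡ s≢0)) ⟩
  Σℚ (λ j → 1ℚ * (c j * p j i))               ≡⟨ Σℚ-cong (λ j → *-identityˡ (c j * p j i)) ⟩
  Σℚ (λ j → c j * p j i)                      ≡⟨ ΣV-coord (λ j → c j ·V p j) i ⟨
  ΣV (λ j → c j ·V p j) i                     ∎
  where
  open ≡-Reasoning
  regroup : ∀ s a s⁻¹ b → s * (a * s⁻¹ * b) ≡ s⁻¹ * s * (a * b)
  regroup = solve-∀ ℚ-ring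

Conv-peel : ∀ {k d} {p : Fin (suc k) → Vect d} {x} ((c , _) : Conv p x) → c zero < 1ℚ →
  ∃ λ y → Conv (p ∘ suc) y × x ≋ ((c zero ·V p zero) +V ((1ℚ - c zero) ·V y))
Conv-peel {k} {p = p} {x} (c , c≥0 , Σc≡1 , x≋) c₀<1 =
  y , (c′ , (λ j → 0≤* (c≥0 (suc j)) (<⇒≤ (⁻¹-pos s>0))) , Σc′≡1 , (λ _ → refl)) ,
  λ i → trans (x≋ i) (cong (c zero * p zero i +_) (sym (ΣV-rescale (>⇒≢ s>0) (c ∘ suc) (p ∘ suc) i)))
  where
  open ≡-Reasoning
  s : ℚ
  s = 1ℚ - c zero
  s>0 : 0ℚ < s
  s>0 = <⇒0<- c₀<1
  c′ : Fin k → ℚ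
  c′ j = c (suc j) * s ⁻¹
  y : Vect _
  y = ΣV (λ j → c′ j ·V p (suc j))
  s≡Σrest : s ≡ Σℚ (c ∘ suc)
  s≡Σrest = begin
    1ℚ - c zero                      ≡⟨ cong (_- c zero) Σc≡1 ⟨
    c zero + Σℚ (c ∘ suc) - c zero   ≡⟨ a+b-a≡b (c zero) (Σℚ (c ∘ suc)) ⟩
    Σℚ (c ∘ suc)                     ∎
    where
    a+b-a≡b : ∀ a b → a + b - a ≡ b
    a+b-a≡b = solve-∀ ℚ-ring
  Σc′≡1 : Σℚ c′ ≡ 1ℚ
  Σc′≡1 = begin
    Σℚ (λ j → c (suc j) * s ⁻¹)   ≡⟨ Σℚ-cong (λ j → *-comm (c (suc j)) (s ⁻¹)) ⟩
    Σℚ (λ j → s ⁻¹ * c (suc j))   ≡⟨ *-distribˡ-Σℚ (s ⁻¹) (c ∘ suc) ⟨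
    s ⁻¹ * Σℚ (c ∘ suc)           ≡⟨ cong (s ⁻¹ *_) s≡Σrest ⟨
    s ⁻¹ * s                      ≡⟨ ⁻¹-inverseˡ (>⇒≢ s>0) ⟩
    1ℚ                            ∎

Extreme-Conv⇒generator : ∀ {k d} (p : Fin k → Vect d) {x} → Conv p x → Extreme (Conv p) x →
  ∃ λ j → x ≋ p j
Extreme-Conv⇒generator {zero} p (c , _ , Σc≡1 , _) _ = ⊥-elim (1≢0 (sym Σc≡1))
Extreme-Conv⇒generator {suc k} p {x} x∈@(c , c≥0 , Σc≡1 , _) extreme with c zero ≟ 1ℚ
... | yes c₀≡1 = zero , Conv-weight-one {p = p} x∈ c₀≡1
... | no c₀≢1 = from-peel (Conv-peel {p = p} x∈ c₀<1)
  where
  c₀<1 : c zero < 1ℚ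
  c₀<1 = ≤∧≢⇒< (subst₂ _≤_ (+-identityʳ (c zero)) Σc≡1 (+-monoʳ-≤ (c zero) (Σℚ-nonNeg (c≥0 ∘ suc)))) c₀≢1

  from-peel : (∃ λ y → Conv (p ∘ suc) y × x ≋ ((c zero ·V p zero) +V ((1ℚ - c zero) ·V y))) →
    ∃ λ j → x ≋ p j
  from-peel (y , y∈ , x≋) with c zero ≟ 0ℚ
  ... | yes c₀≡0 = Product.map suc id (Extreme-Conv⇒generator (p ∘ suc) (Conv-resp-≋ y∈ y≋x)
                     (Extreme-anti-⊆ (λ _ → Conv-tail {p = p}) extreme))
    where
    drop-p₀ : ∀ a b → 0ℚ * a + (1ℚ - 0ℚ) * b ≡ b
    drop-p₀ = solve-∀ ℚ-ring
    y≋x : y ≋ x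
    y≋x i = sym (trans (x≋ i) (trans (cong (λ t → t * p zero i + (1ℚ - t) * y i) c₀≡0) (drop-p₀ (p zero i) (y i))))
  ... | no c₀≢0 = zero , λ i → trans (x≋ i) (trans (cong (λ t → c zero * p zero i + (1ℚ - c zero) * t) (sym (p₀≋y i)))
                                                    (collapse (c zero) (p zero i)))
    where
    collapse : ∀ c a → c * a + (1ℚ - c) * a ≡ a
    collapse = solve-∀ ℚ-ring
    p₀≋y : p zero ≋ y
    p₀≋y = extreme (p zero) y (c zero) (Conv-member p zero) (Conv-tail {p = p} y∈)
      (≤∧≢⇒< (c≥0 zero) (c₀≢0 ∘ sym)) c₀<1 x≋

-- Integers inside ℚ

IsInt : ℚ → Set
IsInt p = ∃ λ z → p ≡ z / 1

private
  toℚᵘ-/1 : ∀ z → toℚᵘ (z / 1) ≃ᵘ mkℚᵘ z 0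
  toℚᵘ-/1 z = toℚᵘ-fromℚᵘ (mkℚᵘ z 0)

/1-+ : ∀ z w → z / 1 + w / 1 ≡ (z ℤ.+ w) / 1
/1-+ z w = toℚᵘ-injective (begin
  toℚᵘ (z / 1 + w / 1)          ≈⟨ toℚᵘ-homo-+ (z / 1) (w / 1) ⟩
  toℚᵘ (z / 1) +ᵘ toℚᵘ (w / 1)  ≈⟨ ℚᵘ.+-cong (toℚᵘ-/1 z) (toℚᵘ-/1 w) ⟩
  mkℚᵘ z 0 +ᵘ mkℚᵘ w 0          ≈⟨ ℚᵘ.*≡* (cong (ℤ._* ℤ.+ 1) (cong₂ ℤ._+_ (ℤ.*-identityʳ z) (ℤ.*-identityʳ w))) ⟩
  mkℚᵘ (z ℤ.+ w) 0               ≈⟨ toℚᵘ-/1 (z ℤ.+ w) ⟨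
  toℚᵘ ((z ℤ.+ w) / 1)          ∎)
  where open ℚᵘ.≃-Reasoning

/1-* : ∀ z w → z / 1 * (w / 1) ≡ (z ℤ.* w) / 1
/1-* z w = toℚᵘ-injective (begin
  toℚᵘ (z / 1 * (w / 1))          ≈⟨ toℚᵘ-homo-* (z / 1) (w / 1) ⟩
  toℚᵘ (z / 1) *ᵘ toℚᵘ (w / 1)    ≈⟨ ℚᵘ.*-cong (toℚᵘ-/1 z) (toℚᵘ-/1 w) ⟩
  mkℚᵘ (z ℤ.* w) 0                 ≈⟨ toℚᵘ-/1 (z ℤ.* w) ⟨
  toℚᵘ ((z ℤ.* w) / 1)            ∎)
  where open ℚᵘ.≃-Reasoning

/1-neg : ∀ z → - (z / 1) ≡ (ℤ.- z) / 1
/1-neg z = toℚᵘ-injective (begin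
  toℚᵘ (- (z / 1))     ≈⟨ toℚᵘ-homo‿- (z / 1) ⟩
  ℚᵘ.- toℚᵘ (z / 1)    ≈⟨ ℚᵘ.-‿cong (toℚᵘ-/1 z) ⟩
  mkℚᵘ (ℤ.- z) 0       ≈⟨ toℚᵘ-/1 (ℤ.- z) ⟨
  toℚᵘ ((ℤ.- z) / 1)   ∎)
  where open ℚᵘ.≃-Reasoning

/1-injective : ∀ {z w} → z / 1 ≡ w / 1 → z ≡ w
/1-injective {z} {w} z≡w with ℚᵘ.≃-trans (ℚᵘ.≃-sym (toℚᵘ-/1 z)) (ℚᵘ.≃-trans (toℚᵘ-cong z≡w) (toℚᵘ-/1 w))
... | ℚᵘ.*≡* eq = trans (sym (ℤ.*-identityʳ z)) (trans eq (ℤ.*-identityʳ w))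

/1-cancel-< : ∀ {z w} → z / 1 < w / 1 → z ℤ.< w
/1-cancel-< {z} {w} z<w with ℚᵘ.<-respˡ-≃ (toℚᵘ-/1 z) (ℚᵘ.<-respʳ-≃ (toℚᵘ-/1 w) (toℚᵘ-mono-< z<w))
... | ℚᵘ.*<* lt = subst₂ ℤ._<_ (ℤ.*-identityʳ z) (ℤ.*-identityʳ w) lt

/1-mono-≤ : ∀ {z w} → z ℤ.≤ w → z / 1 ≤ w / 1
/1-mono-≤ {z} {w} z≤w = toℚᵘ-cancel-≤
  (ℚᵘ.≤-respˡ-≃ (ℚᵘ.≃-sym (toℚᵘ-/1 z)) (ℚᵘ.≤-respʳ-≃ (ℚᵘ.≃-sym (toℚᵘ-/1 w))
    (ℚᵘ.*≤* (subst₂ ℤ._≤_ (sym (ℤ.*-identityʳ z)) (sym (ℤ.*-identityʳ w)) z≤w))))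

IsInt-+ : ∀ {p q} → IsInt p → IsInt q → IsInt (p + q)
IsInt-+ (z , refl) (w , refl) = z ℤ.+ w , /1-+ z w

IsInt-* : ∀ {p q} → IsInt p → IsInt q → IsInt (p * q)
IsInt-* (z , refl) (w , refl) = z ℤ.* w , /1-* z w

IsInt-neg : ∀ {p} → IsInt p → IsInt (- p)
IsInt-neg (z , refl) = ℤ.- z , /1-neg z

IsInt-1 : IsInt 1ℚ
IsInt-1 = ℤ.+ 1 , refl

IsInt-Σℚ : ∀ {k} {f : Fin k → ℚ} → (∀ j → IsInt (f j)) → IsInt (Σℚ f)
IsInt-Σℚ {zero} _ = ℤ.+ 0 , refl
IsInt-Σℚ {suc k} f∈ℤ = IsInt-+ (f∈ℤ zero) (IsInt-Σℚ (f∈ℤ ∘ suc))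

IsInt-⟨⟩ : ∀ {d} {x y : Vect d} → Integral x → Integral y → IsInt ⟨ x , y ⟩
IsInt-⟨⟩ (w , x≋) (w′ , y≋) = IsInt-Σℚ (λ i → IsInt-* (w i , x≋ i) (w′ i , y≋ i))

Integral-resp-≋ : ∀ {d} {x y : Vect d} → Integral x → x ≋ y → Integral y
Integral-resp-≋ (w , x≋) x≋y = w , λ i → trans (sym (x≋y i)) (x≋ i)

Integral-minus : ∀ {d} {x y : Vect d} → Integral x → Integral y → Integral (x -V y)
Integral-minus {x = x} {y} (w , x≋) (w′ , y≋) = (λ i → w i ℤ.- w′ i) , λ i → begin
  x i - y i                 ≡⟨ cong₂ _-_ (x≋ i) (y≋ i) ⟩
  w i / 1 - w′ i / 1        ≡⟨ cong (w i / 1 +_) (/1-neg (w′ i)) ⟩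
  w i / 1 + (ℤ.- w′ i) / 1  ≡⟨ /1-+ (w i) (ℤ.- w′ i) ⟩
  (w i ℤ.- w′ i) / 1        ∎
  where open ≡-Reasoning

IsInt-discrete : ∀ {p q} → IsInt p → IsInt q → p < q → p + 1ℚ ≤ q
IsInt-discrete (z , refl) (w , refl) z<w =
  subst (_≤ w / 1) (sym (/1-+ z (ℤ.+ 1)))
    (/1-mono-≤ (subst (ℤ._≤ w) (ℤ.+-comm (ℤ.+ 1) z) (ℤ.i<j⇒suc[i]≤j (/1-cancel-< {z} z<w))))

IsInt-≡-1 : ∀ {p} → IsInt p → -1ℚ ≤ p → p < 0ℚ → p ≡ -1ℚ
IsInt-≡-1 {p} p∈ℤ -1≤p p<0 = ≤-antisym p≤-1 -1≤p
  where
  p≤-1 : p ≤ -1ℚ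
  p≤-1 = subst (_≤ -1ℚ) p+1-1≡p (+-monoˡ-≤ -1ℚ (IsInt-discrete p∈ℤ (ℤ.+ 0 , refl) p<0))
    where
    p+1-1≡p : p + 1ℚ + -1ℚ ≡ p
    p+1-1≡p = solve (p ∷ []) ℚ-ring

IsInt-≡1 : ∀ {p} → IsInt p → 0ℚ < p → p ≤ 1ℚ → p ≡ 1ℚ
IsInt-≡1 p∈ℤ 0<p p≤1 = ≤-antisym p≤1 (IsInt-discrete (ℤ.+ 0 , refl) p∈ℤ 0<p)

IsInt-1or2 : ∀ {p} → IsInt p → 0ℚ < p → p ≤ 1ℚ + 1ℚ → p ≡ 1ℚ ⊎ p ≡ 1ℚ + 1ℚ
IsInt-1or2 {p} p∈ℤ 0<p p≤2 with p ≟ 1ℚ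
... | yes p≡1 = inj₁ p≡1
... | no p≢1 = inj₂ (≤-antisym p≤2 (IsInt-discrete IsInt-1 p∈ℤ 1<p))
  where
  1<p : 1ℚ < p
  1<p = ≤∧≢⇒< (IsInt-discrete (ℤ.+ 0 , refl) p∈ℤ 0<p) (p≢1 ∘ sym)

IsSign⇒IsInt : ∀ {s} → IsSign s → IsInt s
IsSign⇒IsInt (inj₁ refl) = IsInt-1
IsSign⇒IsInt (inj₂ refl) = IsInt-neg IsInt-1

-- Facets and their normals

Face : ∀ {d} → Pred (Vect d) 0ℓ → Vect d → Pred (Vect d) 0ℓ
Face S η y = S y × ⟨ η , y ⟩ ≡ -1ℚ

record FacetNormal {d} (S G : Pred (Vect d) 0ℓ) (η : Vect d) : Set where
  field
    bounded : Dual S η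
    cuts-out : ∀ y → G y ⇔ Face S η y

  on-facet : ∀ {y} → G y → ⟨ η , y ⟩ ≡ -1ℚ
  on-facet {y} y∈G = proj₂ (to (cuts-out y) y∈G)

  facet⊆ : ∀ {y} → G y → S y
  facet⊆ {y} y∈G = proj₁ (to (cuts-out y) y∈G)

  in-facet : ∀ {y} → S y → ⟨ η , y ⟩ ≡ -1ℚ → G y
  in-facet {y} y∈S tight = from (cuts-out y) (y∈S , tight)

FacetNormal-resp-≋ : ∀ {d} {S G : Pred (Vect d) 0ℓ} {η η′} → FacetNormal S G η → η ≋ η′ → FacetNormal S G η′
FacetNormal-resp-≋ {η = η} {η′} normal η≋η′ = record
  { bounded = λ y y∈S → subst (-1ℚ ≤_) (η≡ y) (bounded y y∈S)
  ; cuts-out = λ y → mk⇔ (λ y∈G → Product.map id (trans (sym (η≡ y))) (to (cuts-out y) y∈G))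
                         (λ (y∈S , tight) → in-facet y∈S (trans (η≡ y) tight))
  }
  where
  open FacetNormal normal
  η≡ : ∀ y → ⟨ η , y ⟩ ≡ ⟨ η′ , y ⟩
  η≡ y = ⟨⟩-congˡ y η≋η′

ZeroInInterior⇒∋0 : ∀ {d} {S : Pred (Vect d) 0ℓ} → ZeroInInterior S → S zeroV
ZeroInInterior⇒∋0 (ε , ε>0 , box⊆S) = box⊆S zeroV (λ _ → neg-antimono-≤ (<⇒≤ ε>0) , <⇒≤ ε>0)

interior-nonNeg⇒zero : ∀ {d} {S : Pred (Vect d) 0ℓ} → ZeroInInterior S → (a : Vect d) →
  (∀ y → S y → 0ℚ ≤ ⟨ a , y ⟩) → ∀ i → a i ≡ 0ℚ
interior-nonNeg⇒zero (ε , ε>0 , box⊆S) a a≥0 i = ≤-antisym aᵢ≤0 0≤aᵢ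
  where
  -ε≤ε : - ε ≤ ε
  -ε≤ε = ≤-trans (neg-antimono-≤ (<⇒≤ ε>0)) (<⇒≤ ε>0)
  in-box : ∀ t → - ε ≤ t → t ≤ ε → ∀ j → (- ε ≤ t * δ i j) × (t * δ i j ≤ ε)
  in-box t -ε≤t t≤ε j with i ≟ᶠ j
  ... | yes _ = subst (- ε ≤_) (sym (*-identityʳ t)) -ε≤t , subst (_≤ ε) (sym (*-identityʳ t)) t≤ε
  ... | no _ = subst (- ε ≤_) (sym (*-zeroʳ t)) (neg-antimono-≤ (<⇒≤ ε>0)) , subst (_≤ ε) (sym (*-zeroʳ t)) (<⇒≤ ε>0)
  0≤at : ∀ t → - ε ≤ t → t ≤ ε → 0ℚ ≤ t * a i
  0≤at t -ε≤t t≤ε = subst (0ℚ ≤_) value (a≥0 (t ·V δ i) (box⊆S (t ·V δ i) (in-box t -ε≤t t≤ε)))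
    where
    value : ⟨ a , t ·V δ i ⟩ ≡ t * a i
    value = trans (⟨⟩-*ʳ a t (δ i)) (cong (t *_) (Σℚ-δ i a))
  instance _ = positive ε>0
  0≤aᵢ : 0ℚ ≤ a i
  0≤aᵢ = *-cancelˡ-≤-pos ε (begin
    ε * 0ℚ   ≡⟨ *-zeroʳ ε ⟩
    0ℚ       ≤⟨ 0≤at ε -ε≤ε ≤-refl ⟩
    ε * a i  ∎)
    where open ≤-Reasoning
  aᵢ≤0 : a i ≤ 0ℚ
  aᵢ≤0 = *-cancelˡ-≤-pos ε (begin
    ε * a i          ≡⟨ neg-involutive (ε * a i) ⟨
    - - (ε * a i)    ≡⟨ cong -_ (neg-distribˡ-* ε (a i)) ⟩
    - (- ε * a i)    ≤⟨ neg-antimono-≤ (0≤at (- ε) ≤-refl -ε≤ε) ⟩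
    0ℚ               ≡⟨ *-zeroʳ ε ⟨
    ε * 0ℚ           ∎)
    where open ≤-Reasoning

facetNormal : ∀ {d} {S G : Pred (Vect d) 0ℓ} → ZeroInInterior S → IsFacet S G → ∃ (FacetNormal S G)
facetNormal 0∈S° ((a , c , (i , aᵢ≢0) , c≤ , G⇔) , _) = η , record
  { bounded = λ y y∈S → *-cancelˡ-≤-pos (- c) (subst₂ _≤_ c≡ (a≡ y) (c≤ y y∈S))
  ; cuts-out = λ y → mk⇔ (λ y∈G → let y∈S , tight = to (G⇔ y) y∈G in y∈S , normalise tight)
                         (λ (y∈S , tight) → from (G⇔ y) (y∈S , trans (a≡ y) (trans (cong (- c *_) tight) (sym c≡))))
  }
  where
  c≤0 : c ≤ 0ℚ
  c≤0 = subst (c ≤_) (⟨⟩-zeroʳ a) (c≤ zeroV (ZeroInInterior⇒∋0 0∈S°))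
  c≢0 : c ≢ 0ℚ
  c≢0 c≡0 = aᵢ≢0 (interior-nonNeg⇒zero 0∈S° a (λ y y∈S → subst (_≤ ⟨ a , y ⟩) c≡0 (c≤ y y∈S)) i)
  -c>0 : 0ℚ < - c
  -c>0 = neg-antimono-< (≤∧≢⇒< c≤0 c≢0)
  instance _ = positive -c>0
  η : Vect _
  η = ((- c) ⁻¹) ·V a
  a≡ : ∀ y → ⟨ a , y ⟩ ≡ - c * ⟨ η , y ⟩
  a≡ y = begin
    ⟨ a , y ⟩                          ≡⟨ *-identityˡ (⟨ a , y ⟩) ⟨
    1ℚ * ⟨ a , y ⟩                     ≡⟨ cong (_* ⟨ a , y ⟩) (⁻¹-inverseˡ (>⇒≢ -c>0)) ⟨
    (- c) ⁻¹ * - c * ⟨ a , y ⟩         ≡⟨ cong (_* ⟨ a , y ⟩) (*-comm ((- c) ⁻¹) (- c)) ⟩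
    - c * (- c) ⁻¹ * ⟨ a , y ⟩         ≡⟨ *-assoc (- c) ((- c) ⁻¹) (⟨ a , y ⟩) ⟩
    - c * ((- c) ⁻¹ * ⟨ a , y ⟩)       ≡⟨ cong (- c *_) (⟨⟩-*ˡ ((- c) ⁻¹) a y) ⟨
    - c * ⟨ η , y ⟩                    ∎
    where open ≡-Reasoning
  c≡ : c ≡ - c * -1ℚ
  c≡ = solve (c ∷ []) ℚ-ring
  normalise : ∀ {y} → ⟨ a , y ⟩ ≡ c → ⟨ η , y ⟩ ≡ -1ℚ
  normalise {y} tight = *-cancelˡ-≡ (>⇒≢ -c>0) (trans (sym (a≡ y)) (trans tight c≡))

TightDetermined : ∀ {d} → Pred (Vect d) 0ℓ → Vect d → Set
TightDetermined S x = ∀ a b → (∀ y → Face S x y → ⟨ a , y ⟩ ≡ ⟨ b , y ⟩) → a ≋ b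

TightDetermined⇒Extreme : ∀ {d} {S : Pred (Vect d) 0ℓ} {x} → Dual S x → TightDetermined S x →
  Extreme (Dual S) x
TightDetermined⇒Extreme {x = x} _ determined a b t a∈S* b∈S* 0<t t<1 x≋ =
  determined a b λ y (y∈S , tight) →
    let a≡ , b≡ = convex-≡-lower 0<t t<1 (a∈S* y y∈S) (b∈S* y y∈S) (split y tight) in trans a≡ (sym b≡)
  where
  split : ∀ y → ⟨ x , y ⟩ ≡ -1ℚ → t * ⟨ a , y ⟩ + (1ℚ - t) * ⟨ b , y ⟩ ≡ -1ℚ
  split y tight = trans (sym (⟨⟩-convexˡ a b y t)) (trans (sym (⟨⟩-congˡ y x≋)) tight)

-- x is then a vertex of the lattice polytope S*.
Integral-if-TightDetermined : ∀ {d} {S : Pred (Vect d) 0ℓ} {x} → IsLatticePolytope (Dual S) →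
  Dual S x → TightDetermined S x → Integral x
Integral-if-TightDetermined {x = x} (_ , W , S*⇔) x∈S* determined =
  Product.map W id (Extreme-Conv⇒generator (λ j → embed (W j)) (to (S*⇔ x) x∈S*)
    (Extreme-anti-⊆ (λ y → from (S*⇔ y)) (TightDetermined⇒Extreme x∈S* determined)))

IsFacet-resp-≋ : ∀ {k d} {p : Fin k → Vect d} {G} → IsFacet (Conv p) G → ∀ {y y′} → G y → y ≋ y′ → G y′
IsFacet-resp-≋ ((a , _ , _ , _ , G⇔) , _) {y} {y′} y∈G y≋y′ =
  let y∈P , tight = to (G⇔ y) y∈G in
  from (G⇔ y′) (Conv-resp-≋ y∈P y≋y′ , trans (sym (⟨⟩-congʳ a y≋y′)) tight)

Face-resp-≋ : ∀ {k d} {p : Fin k → Vect d} {x y y′} → Face (Conv p) x y → y ≋ y′ → Face (Conv p) x y′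
Face-resp-≋ {x = x} (y∈P , tight) y≋y′ = Conv-resp-≋ y∈P y≋y′ , trans (sym (⟨⟩-congʳ x y≋y′)) tight

-- Signed sums over subsets

indicator : Bool → ℚ
indicator true = 1ℚ
indicator false = 0ℚ

ternary≡indicators : ∀ {x} → x ≡ -1ℚ ⊎ x ≡ 0ℚ ⊎ x ≡ 1ℚ →
  x ≡ indicator (isYes (0ℚ <? x)) - indicator (isYes (x <? 0ℚ))
ternary≡indicators (inj₁ refl) = refl
ternary≡indicators (inj₂ (inj₁ refl)) = refl
ternary≡indicators (inj₂ (inj₂ refl)) = refl

∈-tabulate : ∀ {n} {b : Fin n → Bool} {i} → i ∈ tabulate b → b i ≡ true
∈-tabulate {b = b} {i} i∈ = trans (sym (lookup∘tabulate b i)) ([]=⇒lookup i∈)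

∣tabulate∣ : ∀ {n} (b : Fin n → Bool) → (ℤ.+ ∣ tabulate b ∣) / 1 ≡ Σℚ (indicator ∘ b)
∣tabulate∣ {zero} b = refl
∣tabulate∣ {suc n} b with b zero
... | true = trans (sym (/1-+ (ℤ.+ 1) (ℤ.+ ∣ tabulate (b ∘ suc) ∣))) (cong (1ℚ +_) (∣tabulate∣ (b ∘ suc)))
... | false = trans (∣tabulate∣ (b ∘ suc)) (sym (+-identityˡ _))

ΣSub-tabulate : ∀ {d} (b : Fin d → Bool) (p : Fin d → Vect d) k →
  ΣSub (tabulate b) p k ≡ Σℚ (λ m → indicator (b m) * p m k)
ΣSub-tabulate b p k = trans (ΣV-coord (λ m → if lookup (tabulate b) m then p m else zeroV) k)
  (Σℚ-cong λ m → trans (cong (λ β → (if β then p m else zeroV) k) (lookup∘tabulate b m)) (select (b m)))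
  where
  select : ∀ {m} β → (if β then p m else zeroV) k ≡ indicator β * p m k
  select {m} true = sym (*-identityˡ (p m k))
  select {m} false = sym (*-zeroˡ (p m k))

balanced-signed-sum : ∀ {d} (p : Fin d → Vect d) (q : Fin d → ℚ) →
  (∀ m → q m ≡ -1ℚ ⊎ q m ≡ 0ℚ ⊎ q m ≡ 1ℚ) → Σℚ q ≡ 0ℚ → ∀ {v} → v ≋ ΣV (λ i → q i ·V p i) →
  Σ (Subset d) λ I → Σ (Subset d) λ J →
    (∀ i → i ∈ I → i ∉ J) × (∣ I ∣ ≡ ∣ J ∣) × (v ≋ (ΣSub J p -V ΣSub I p))
balanced-signed-sum {d} p q q-values Σq≡0 v≋ =
  tabulate isNeg , tabulate isPos , disjoint , equal-size , λ k → trans (v≋ k) (split k)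
  where
  open ≡-Reasoning
  isNeg isPos : Fin d → Bool
  isNeg m = isYes (q m <? 0ℚ)
  isPos m = isYes (0ℚ <? q m)

  q≡ : ∀ m → q m ≡ indicator (isPos m) - indicator (isNeg m)
  q≡ m = ternary≡indicators (q-values m)

  disjoint : ∀ i → i ∈ tabulate isNeg → i ∉ tabulate isPos
  disjoint i i∈I i∈J = <-asym (toWitness {a? = q i <? 0ℚ} (from T-≡ (∈-tabulate i∈I)))
                              (toWitness {a? = 0ℚ <? q i} (from T-≡ (∈-tabulate i∈J)))

  equal-size : ∣ tabulate isNeg ∣ ≡ ∣ tabulate isPos ∣
  equal-size = ℤ.+-injective (/1-injective (begin
    (ℤ.+ ∣ tabulate isNeg ∣) / 1   ≡⟨ ∣tabulate∣ isNeg ⟩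
    Σℚ (indicator ∘ isNeg)        ≡⟨ p-q≡0⇒p≡q _ _ difference ⟨
    Σℚ (indicator ∘ isPos)        ≡⟨ ∣tabulate∣ isPos ⟨
    (ℤ.+ ∣ tabulate isPos ∣) / 1   ∎))
    where
    difference : Σℚ (indicator ∘ isPos) - Σℚ (indicator ∘ isNeg) ≡ 0ℚ
    difference = trans (sym (Σℚ-distrib-minus (indicator ∘ isPos) (indicator ∘ isNeg)))
                       (trans (sym (Σℚ-cong q≡)) Σq≡0)

  split : ΣV (λ i → q i ·V p i) ≋ (ΣSub (tabulate isPos) p -V ΣSub (tabulate isNeg) p)
  split k = begin
    ΣV (λ i → q i ·V p i) k                 ≡⟨ ΣV-coord (λ i → q i ·V p i) k ⟩
    Σℚ (λ i → q i * p i k)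
      ≡⟨ Σℚ-cong (λ i → trans (cong (_* p i k) (q≡ i)) (*-distribʳ-minus (p i k) (indicator (isPos i)) (indicator (isNeg i)))) ⟩
    Σℚ (λ i → indicator (isPos i) * p i k - indicator (isNeg i) * p i k)
      ≡⟨ Σℚ-distrib-minus (λ i → indicator (isPos i) * p i k) (λ i → indicator (isNeg i) * p i k) ⟩
    Σℚ (λ i → indicator (isPos i) * p i k) - Σℚ (λ i → indicator (isNeg i) * p i k)
      ≡⟨ cong₂ _-_ (ΣSub-tabulate isPos p k) (ΣSub-tabulate isNeg p k) ⟨
    ΣSub (tabulate isPos) p k - ΣSub (tabulate isNeg) p k ∎
    where
    *-distribʳ-minus : ∀ x a b → (a - b) * x ≡ a * x - b * x
    *-distribʳ-minus = solve-∀ ℚ-ring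

-- The configuration of the lemma

module Antipodal {d k : ℕ} (gens : Fin k → Fin d → ℤ) (0∈P° : ZeroInInterior (polytope gens))
  {F : Pred (Vect d) 0ℓ} (F-facet : IsFacet (polytope gens) F) (-F-facet : IsFacet (polytope gens) (negSet F))
  (e : Fin d → Vect d) (e∈F : ∀ i → F (e i))
  (e* : Fin d → Vect d) (dual : ∀ i j → ⟨ e* i , e j ⟩ ≡ δ i j)
  (u : Vect d) (u-eta : IsEta F u) where

  open Basis e e* dual public

  P : Pred (Vect d) 0ℓ
  P = polytope gens

  u-normal : FacetNormal P F u
  u-normal = FacetNormal-resp-≋ normal (dual-ext λ l → trans (on-facet (e∈F l)) (sym (u-eta (e l) (e∈F l))))
    where
    normal : FacetNormal P F (proj₁ (facetNormal 0∈P° F-facet))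
    normal = proj₂ (facetNormal 0∈P° F-facet)
    open FacetNormal normal

  -e∈-F : ∀ i → negSet F (-V e i)
  -e∈-F i = IsFacet-resp-≋ F-facet (e∈F i) (λ m → sym (neg-involutive (e i m)))

  -u-normal : FacetNormal P (negSet F) (-V u)
  -u-normal = FacetNormal-resp-≋ normal (dual-ext λ l →
    trans (neg-injective (trans (sym (⟨⟩-negʳ η (e l))) (on-facet (-e∈-F l))))
          (sym (trans (⟨⟩-negˡ u (e l)) (cong -_ (u-eta (e l) (e∈F l))))))
    where
    η : Vect d
    η = proj₁ (facetNormal 0∈P° -F-facet)
    normal : FacetNormal P (negSet F) η
    normal = proj₂ (facetNormal 0∈P° -F-facet)
    open FacetNormal normal

  open FacetNormal

  e∈P : ∀ i → P (e i)
  e∈P i = facet⊆ u-normal (e∈F i)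

  -e∈P : ∀ i → P (-V e i)
  -e∈P i = facet⊆ -u-normal (-e∈-F i)

  signed-e∈P : ∀ {s} m → IsSign s → P (s ·V e m)
  signed-e∈P m (inj₁ refl) = Conv-resp-≋ (e∈P m) (λ k → sym (*-identityˡ (e m k)))
  signed-e∈P m (inj₂ refl) = Conv-resp-≋ (-e∈P m) (λ k → sym (-1ℚ·V≋-V (e m) k))

  u≤1 : ∀ {y} → P y → ⟨ u , y ⟩ ≤ 1ℚ
  u≤1 {y} y∈P = subst (_≤ 1ℚ) (neg-involutive ⟨ u , y ⟩)
    (neg-antimono-≤ (subst (-1ℚ ≤_) (⟨⟩-negˡ u y) (bounded -u-normal y y∈P)))

  u≡1⇒-F : ∀ {y} → P y → ⟨ u , y ⟩ ≡ 1ℚ → negSet F y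
  u≡1⇒-F {y} y∈P u≡1 = in-facet -u-normal y∈P (trans (⟨⟩-negˡ u y) (cong -_ u≡1))

  -F⇒u≡1 : ∀ {y} → negSet F y → ⟨ u , y ⟩ ≡ 1ℚ
  -F⇒u≡1 {y} y∈-F = neg-injective (trans (sym (⟨⟩-negˡ u y)) (on-facet -u-normal y∈-F))

  u-coords : ∀ y → ⟨ u , y ⟩ ≡ - Σℚ (λ l → coord l y)
  u-coords y = begin
    ⟨ u , y ⟩                           ≡⟨ ⟨⟩-expand u y ⟩
    Σℚ (λ l → coord l y * ⟨ u , e l ⟩)  ≡⟨ Σℚ-cong (λ l → cong (coord l y *_) (u-eta (e l) (e∈F l))) ⟩
    Σℚ (λ l → coord l y * -1ℚ)          ≡⟨ Σℚ-cong (λ l → *-1≡neg (coord l y)) ⟩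
    Σℚ (λ l → - coord l y)              ≡⟨ Σℚ-neg (λ l → coord l y) ⟩
    - Σℚ (λ l → coord l y)              ∎
    where open ≡-Reasoning

  -F-coord-sum : ∀ {y} → negSet F y → Σℚ (λ l → coord l y) ≡ -1ℚ
  -F-coord-sum {y} y∈-F = neg-injective (trans (sym (u-coords y)) (-F⇒u≡1 y∈-F))

  signed-basis-face : ∀ {x} (σ : Fin d → ℚ) → (∀ m → IsSign (σ m)) → Dual P x →
    (∀ m → Face P x (σ m ·V e m)) → Fin d → IsFacet P (Face P x)
  signed-basis-face {x} σ σ-sign x∈P* tight i =
    (x , -1ℚ , nonZero-if-tight (proj₂ (tight i)) , x∈P* , λ y → mk⇔ id id) ,
    (λ m → σ m ·V e m) , tight , signed-basis-affInd σ σ-sign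

  module Adjacent (Fi : Fin d → Pred (Vect d) 0ℓ) (Fi-facet : ∀ i → IsFacet P (Fi i))
    (Fi∩F : ∀ i y → (Fi i y × F y) ⇔ ConvExcept e i y) where

    e∈Fi : ∀ {i j} → j ≢ i → Fi i (e j)
    e∈Fi {i} {j} j≢i = proj₁ (from (Fi∩F i (e j)) (ConvExcept-member e j≢i))

    module AdjacentFacet (i : Fin d) where

      η : Vect d
      η = proj₁ (facetNormal 0∈P° (Fi-facet i))

      η-normal : FacetNormal P (Fi i) η
      η-normal = proj₂ (facetNormal 0∈P° (Fi-facet i))

      γ : ℚ
      γ = ⟨ η , e i ⟩ + 1ℚ

      η≋ : η ≋ (u +V (γ ·V e* i))
      η≋ = dual-ext at-e
        where
        at-e : ∀ l → ⟨ η , e l ⟩ ≡ ⟨ u +V (γ ·V e* i) , e l ⟩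
        at-e l = sym (trans (⟨⟩-+ˡ u (γ ·V e* i) (e l))
                 (trans (cong₂ _+_ (u-eta (e l) (e∈F l)) (trans (⟨⟩-*ˡ γ (e* i) (e l)) (cong (γ *_) (dual i l))))
                        (by-cases (i ≟ᶠ l))))
          where
          by-cases : Dec (i ≡ l) → -1ℚ + γ * δ i l ≡ ⟨ η , e l ⟩
          by-cases (yes refl) = trans (cong (λ t → -1ℚ + γ * t) (δ-refl i)) (cancel ⟨ η , e i ⟩)
            where
            cancel : ∀ x → -1ℚ + (x + 1ℚ) * 1ℚ ≡ x
            cancel = solve-∀ ℚ-ring
          by-cases (no i≢l) = trans (cong (λ t → -1ℚ + γ * t) (δ-≢ i≢l))
            (trans (cong (-1ℚ +_) (*-zeroʳ γ)) (sym (on-facet η-normal (e∈Fi (i≢l ∘ sym)))))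

      η-pairing : ∀ y → ⟨ η , y ⟩ ≡ ⟨ u , y ⟩ + γ * coord i y
      η-pairing y = trans (⟨⟩-congˡ y η≋) (trans (⟨⟩-+ˡ u (γ ·V e* i) y) (cong (⟨ u , y ⟩ +_) (⟨⟩-*ˡ γ (e* i) y)))

      γ>0 : 0ℚ < γ
      γ>0 = ≤∧≢⇒< 0≤γ (γ≢0 ∘ sym)
        where
        0≤γ : 0ℚ ≤ γ
        0≤γ = +-monoˡ-≤ 1ℚ (bounded η-normal (e i) (e∈P i))
        γ≢0 : γ ≢ 0ℚ
        γ≢0 γ≡0 = ¬ConvExcept-self i (to (Fi∩F i (e i)) (in-facet η-normal (e∈P i) ηeᵢ≡-1 , e∈F i))
          where
          x≡x+1-1 : ∀ x → x ≡ x + 1ℚ - 1ℚ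
          x≡x+1-1 = solve-∀ ℚ-ring
          ηeᵢ≡-1 : ⟨ η , e i ⟩ ≡ -1ℚ
          ηeᵢ≡-1 = trans (x≡x+1-1 ⟨ η , e i ⟩) (cong (_- 1ℚ) γ≡0)

    open AdjacentFacet

    F-coord-nonNeg : ∀ i {y} → F y → 0ℚ ≤ coord i y
    F-coord-nonNeg i {y} y∈F = 0≤*⇒0≤ (γ>0 i) (subst (0ℚ ≤_) cancel (≤⇒0≤- -1≤η))
      where
      -1≤η : -1ℚ ≤ -1ℚ + γ i * coord i y
      -1≤η = subst (-1ℚ ≤_) (trans (η-pairing i y) (cong (_+ γ i * coord i y) (on-facet u-normal y∈F)))
                   (bounded (η-normal i) y (facet⊆ u-normal y∈F))
      cancel : -1ℚ + γ i * coord i y - -1ℚ ≡ γ i * coord i y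
      cancel = -1+x+1≡x (γ i * coord i y)
        where
        -1+x+1≡x : ∀ x → -1ℚ + x - -1ℚ ≡ x
        -1+x+1≡x = solve-∀ ℚ-ring

    -F-coord-nonPos : ∀ i {y} → negSet F y → coord i y ≤ 0ℚ
    -F-coord-nonPos i {y} y∈-F =
      subst (_≤ 0ℚ) (neg-involutive (coord i y)) (neg-antimono-≤ (subst (0ℚ ≤_) (⟨⟩-negʳ (e* i) y) (F-coord-nonNeg i y∈-F)))

    -F-coord-≥-1 : ∀ i {y} → negSet F y → -1ℚ ≤ coord i y
    -F-coord-≥-1 i {y} y∈-F =
      subst (_≤ coord i y) (-F-coord-sum y∈-F) (Σℚ-nonPos-≤ (λ l → -F-coord-nonPos l y∈-F) i)

    -F-coord-single : ∀ i {y} → negSet F y → (∀ m → m ≢ i → coord m y ≡ 0ℚ) → coord i y ≡ -1ℚ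
    -F-coord-single i {y} y∈-F off-i≡0 = trans (sym (Σℚ-single (λ l → coord l y) i off-i≡0)) (-F-coord-sum y∈-F)

    -e-vertex : ∀ i → IsVertex P (-V e i)
    -e-vertex i = -e∈P i , extreme
      where
      extreme : Extreme P (-V e i)
      extreme a b t a∈P b∈P 0<t t<1 -eᵢ≋ = coord-ext coords≡
        where
        split : ∀ w → ⟨ w , -V e i ⟩ ≡ t * ⟨ w , a ⟩ + (1ℚ - t) * ⟨ w , b ⟩
        split w = trans (⟨⟩-congʳ w -eᵢ≋) (⟨⟩-convexʳ w a b t)
        u-at-a,b : ⟨ u , a ⟩ ≡ 1ℚ × ⟨ u , b ⟩ ≡ 1ℚ
        u-at-a,b = convex-≡-upper 0<t t<1 (u≤1 a∈P) (u≤1 b∈P) (trans (sym (split u)) (-F⇒u≡1 (-e∈-F i)))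
        a∈-F : negSet F a
        a∈-F = u≡1⇒-F a∈P (proj₁ u-at-a,b)
        b∈-F : negSet F b
        b∈-F = u≡1⇒-F b∈P (proj₂ u-at-a,b)
        off-i : ∀ m → m ≢ i → coord m a ≡ 0ℚ × coord m b ≡ 0ℚ
        off-i m m≢i = convex-≡-upper 0<t t<1 (-F-coord-nonPos m a∈-F) (-F-coord-nonPos m b∈-F)
          (trans (sym (split (e* m))) (trans (⟨⟩-negʳ (e* m) (e i)) (cong -_ (trans (dual m i) (δ-≢ m≢i)))))
        coords≡ : ∀ m → coord m a ≡ coord m b
        coords≡ m = by-index (m ≟ᶠ i)
          where
          by-index : Dec (m ≡ i) → coord m a ≡ coord m b
          by-index (yes refl) = trans (-F-coord-single i a∈-F (λ m m≢i → proj₁ (off-i m m≢i)))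
                                      (sym (-F-coord-single i b∈-F (λ m m≢i → proj₂ (off-i m m≢i))))
          by-index (no m≢i) = trans (proj₁ (off-i m m≢i)) (sym (proj₂ (off-i m m≢i)))

    -- Otherwise the d affinely independent points spanning F_i would lie in the (d-2)-flat
    -- {η_i = -1, coord_i = 0}.
    Fi-off-hyperplane : ∀ i → ∃ λ p → Fi i p × coord i p ≢ 0ℚ
    Fi-off-hyperplane i = from-points (proj₂ (Fi-facet i))
      where
      from-points : (Σ (Fin d → Vect d) λ pts → (∀ j → Fi i (pts j)) × AffInd pts) →
        ∃ λ p → Fi i p × coord i p ≢ 0ℚ
      from-points (pts , pts∈Fi , pts-affInd) = by-dec (all? (λ j → coord i (pts j) ≟ 0ℚ))
        where
        open ≡-Reasoning
        no-relation : HasNontrivialSolution (λ m j → coord m (pts j)) → ⊥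
        no-relation (c , (j , cⱼ≢0) , rows≡0) = cⱼ≢0 (pts-affInd c Σc≡0 z≋0 j)
          where
          z≋0 : ΣV (λ j → c j ·V pts j) ≋ zeroV
          z≋0 = coord-ext λ m → begin
            coord m (ΣV (λ j → c j ·V pts j))   ≡⟨ coord-ΣV m c pts ⟩
            Σℚ (λ j → c j * coord m (pts j))    ≡⟨ Σℚ-cong (λ j → *-comm (c j) (coord m (pts j))) ⟩
            Σℚ (λ j → coord m (pts j) * c j)    ≡⟨ rows≡0 m ⟩
            0ℚ                                  ≡⟨ ⟨⟩-zeroʳ (e* m) ⟨
            coord m zeroV                       ∎
          Σc≡0 : Σℚ c ≡ 0ℚ
          Σc≡0 = neg-injective (begin
            - Σℚ c                                    ≡⟨ Σℚ-neg c ⟨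
            Σℚ (λ j → - c j)                          ≡⟨ Σℚ-cong (λ j → *-1≡neg (c j)) ⟨
            Σℚ (λ j → c j * -1ℚ)                      ≡⟨ Σℚ-cong (λ j → cong (c j *_) (on-facet (η-normal i) (pts∈Fi j))) ⟨
            Σℚ (λ j → c j * ⟨ η i , pts j ⟩)          ≡⟨ ⟨⟩-ΣVʳ (η i) c pts ⟨
            ⟨ η i , ΣV (λ j → c j ·V pts j) ⟩         ≡⟨ ⟨⟩-congʳ (η i) z≋0 ⟩
            ⟨ η i , zeroV ⟩                           ≡⟨ ⟨⟩-zeroʳ (η i) ⟩
            0ℚ                                        ∎)
        by-dec : Dec (∀ j → coord i (pts j) ≡ 0ℚ) → ∃ λ p → Fi i p × coord i p ≢ 0ℚ
        by-dec (yes all≡0) = ⊥-elim (no-relation (zero-row-nontrivial (λ m j → coord m (pts j)) i all≡0))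
        by-dec (no ¬all≡0) = Product.map pts (λ {j} coordᵢ≢0 → pts∈Fi j , coordᵢ≢0)
          (¬∀⟶∃¬ d _ (λ j → coord i (pts j) ≟ 0ℚ) ¬all≡0)

    module Lattice (e-vertex : ∀ i → IsVertex P (e i)) (vertex-integral : ∀ x → IsVertex P x → Integral x)
      (dual-lattice : IsLatticePolytope (Dual P)) where

      signed-e-vertex : ∀ {s} m → IsSign s → IsVertex P (s ·V e m)
      signed-e-vertex m (inj₁ refl) = IsVertex-resp-≋ (e-vertex m) (λ k → sym (*-identityˡ (e m k)))
      signed-e-vertex m (inj₂ refl) = IsVertex-resp-≋ (-e-vertex m) (λ k → sym (-1ℚ·V≋-V (e m) k))

      e-integral : ∀ i → Integral (e i)
      e-integral i = vertex-integral (e i) (e-vertex i)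

      u-integral : Integral u
      u-integral = Integral-if-TightDetermined dual-lattice (bounded u-normal)
        λ a b agree → dual-ext λ l → agree (e l) (e∈P l , u-eta (e l) (e∈F l))

      -- ε = 1, t = γ_i gives the normal of F_i; ε = -1 gives the vertices of P* behind -F.
      module SignedShift {ε : ℚ} (ε-sign : IsSign ε) (t : ℚ) (i : Fin d) where

        w : Vect d
        w = ε ·V (u +V (t ·V e* i))

        w-pairing : ∀ y → ⟨ w , y ⟩ ≡ ε * (⟨ u , y ⟩ + t * coord i y)
        w-pairing y = trans (⟨⟩-*ˡ ε (u +V (t ·V e* i)) y)
          (cong (ε *_) (trans (⟨⟩-+ˡ u (t ·V e* i) y) (cong (⟨ u , y ⟩ +_) (⟨⟩-*ˡ t (e* i) y))))

        w-at-signed-e : ∀ s m → ⟨ w , s ·V e m ⟩ ≡ s * (ε * (-1ℚ + t * δ i m))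
        w-at-signed-e s m = trans (⟨⟩-*ʳ w s (e m))
          (cong (s *_) (trans (w-pairing (e m)) (cong₂ (λ a b → ε * (a + t * b)) (u-eta (e m) (e∈F m)) (dual i m))))

        ε*ε* : ∀ x → ε * (ε * x) ≡ x
        ε*ε* x = trans (sym (*-assoc ε ε x)) (trans (cong (_* x) (IsSign-squared ε-sign)) (*-identityˡ x))

        w-tight-off-i : ∀ m → m ≢ i → Face P w (ε ·V e m)
        w-tight-off-i m m≢i = signed-e∈P m ε-sign , (begin
          ⟨ w , ε ·V e m ⟩              ≡⟨ w-at-signed-e ε m ⟩
          ε * (ε * (-1ℚ + t * δ i m))   ≡⟨ ε*ε* (-1ℚ + t * δ i m) ⟩
          -1ℚ + t * δ i m               ≡⟨ cong (λ x → -1ℚ + t * x) (δ-≢ (m≢i ∘ sym)) ⟩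
          -1ℚ + t * 0ℚ                  ≡⟨ cong (-1ℚ +_) (*-zeroʳ t) ⟩
          -1ℚ                           ∎)
          where open ≡-Reasoning

        w-at-±e-i : ∀ {s} → IsSign s → ⟨ w , (s * ε) ·V e i ⟩ ≡ s * (t - 1ℚ)
        w-at-±e-i {s} _ = begin
          ⟨ w , (s * ε) ·V e i ⟩             ≡⟨ w-at-signed-e (s * ε) i ⟩
          s * ε * (ε * (-1ℚ + t * δ i i))    ≡⟨ *-assoc s ε (ε * (-1ℚ + t * δ i i)) ⟩
          s * (ε * (ε * (-1ℚ + t * δ i i)))  ≡⟨ cong (s *_) (ε*ε* (-1ℚ + t * δ i i)) ⟩
          s * (-1ℚ + t * δ i i)              ≡⟨ cong (λ x → s * (-1ℚ + t * x)) (δ-refl i) ⟩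
          s * (-1ℚ + t * 1ℚ)                 ≡⟨ cong (s *_) (simplify t) ⟩
          s * (t - 1ℚ)                       ∎
          where
          open ≡-Reasoning
          simplify : ∀ t → -1ℚ + t * 1ℚ ≡ t - 1ℚ
          simplify = solve-∀ ℚ-ring

        w-integral : Dual P w → ∀ {p} → Face P w p → coord i p ≢ 0ℚ → Integral w
        w-integral w∈P* {p} p-tight pᵢ≢0 = Integral-if-TightDetermined dual-lattice w∈P* λ a b agree →
          dual-ext-except i pᵢ≢0
            (λ m m≢i → *-cancelˡ-≡ (IsSign⇒≢0 ε-sign)
              (trans (sym (⟨⟩-*ʳ a ε (e m))) (trans (agree _ (w-tight-off-i m m≢i)) (⟨⟩-*ʳ b ε (e m)))))
            (agree p p-tight)

        t-1or2 : Dual P w → Integral w → 0ℚ < t → t ≡ 1ℚ ⊎ t ≡ 1ℚ + 1ℚ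
        t-1or2 w∈P* w-integral 0<t = IsInt-1or2 t∈ℤ 0<t t≤2
          where
          t-1∈ℤ : IsInt (1ℚ * (t - 1ℚ))
          t-1∈ℤ = subst IsInt (trans (sym (⟨⟩-*ʳ w (1ℚ * ε) (e i))) (w-at-±e-i (inj₁ refl)))
                    (IsInt-* (IsSign⇒IsInt (IsSign-* (inj₁ refl) ε-sign)) (IsInt-⟨⟩ w-integral (e-integral i)))
          t∈ℤ : IsInt t
          t∈ℤ = subst IsInt (1*[x-1]+1≡x t) (IsInt-+ t-1∈ℤ IsInt-1)
            where
            1*[x-1]+1≡x : ∀ x → 1ℚ * (x - 1ℚ) + 1ℚ ≡ x
            1*[x-1]+1≡x = solve-∀ ℚ-ring
          t≤2 : t ≤ 1ℚ + 1ℚ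
          t≤2 = 0≤-⇒≤ (subst (0ℚ ≤_) (rearrange t)
                  (≤⇒0≤- (subst (-1ℚ ≤_) (w-at-±e-i (inj₂ refl)) (w∈P* _ (signed-e∈P i (IsSign-* (inj₂ refl) ε-sign))))))
            where
            rearrange : ∀ x → -1ℚ * (x - 1ℚ) - -1ℚ ≡ 1ℚ + 1ℚ - x
            rearrange = solve-∀ ℚ-ring

      module AdjacentNormal (i : Fin d) where
        open SignedShift (inj₁ refl) (γ i) i public

        η≋w : η i ≋ w
        η≋w k = trans (η≋ i k) (sym (*-identityˡ _))

        w∈P* : Dual P w
        w∈P* y y∈P = subst (-1ℚ ≤_) (⟨⟩-congˡ y η≋w) (bounded (η-normal i) y y∈P)

        η-integral : Integral (η i)
        η-integral = from-point (Fi-off-hyperplane i)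
          where
          from-point : (∃ λ p → Fi i p × coord i p ≢ 0ℚ) → Integral (η i)
          from-point (p , p∈Fi , pᵢ≢0) = Integral-resp-≋ (w-integral w∈P* p-tight pᵢ≢0) (λ k → sym (η≋w k))
            where
            p-tight : Face P w p
            p-tight = facet⊆ (η-normal i) p∈Fi , trans (sym (⟨⟩-congˡ p η≋w)) (on-facet (η-normal i) p∈Fi)

        e*∈P* : γ i ≡ 1ℚ → Dual P (e* i)
        e*∈P* γ≡1 y y∈P = Conv-lowerBound (e* i) -1ℚ (λ j → at-generator j (⟨ u , g j ⟩ ≤? 0ℚ)) y∈P
          where
          g : Fin k → Vect d
          g j = embed (gens j)
          at-generator : ∀ j → Dec (⟨ u , g j ⟩ ≤ 0ℚ) → -1ℚ ≤ coord i (g j)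
          at-generator j (yes u≤0) = begin
            -1ℚ                                   ≤⟨ bounded (η-normal i) (g j) (Conv-member g j) ⟩
            ⟨ η i , g j ⟩                          ≡⟨ η-pairing i (g j) ⟩
            ⟨ u , g j ⟩ + γ i * coord i (g j)      ≡⟨ cong (λ t → ⟨ u , g j ⟩ + t * coord i (g j)) γ≡1 ⟩
            ⟨ u , g j ⟩ + 1ℚ * coord i (g j)       ≤⟨ +-monoˡ-≤ (1ℚ * coord i (g j)) u≤0 ⟩
            0ℚ + 1ℚ * coord i (g j)                ≡⟨ 0+1*x≡x (coord i (g j)) ⟩
            coord i (g j)                          ∎
            where
            open ≤-Reasoning
            0+1*x≡x : ∀ x → 0ℚ + 1ℚ * x ≡ x
            0+1*x≡x = solve-∀ ℚ-ring
          at-generator j (no u≰0) = -F-coord-≥-1 i (u≡1⇒-F (Conv-member g j) u≡1)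
            where
            u≡1 : ⟨ u , g j ⟩ ≡ 1ℚ
            u≡1 = IsInt-≡1 (IsInt-⟨⟩ u-integral (gens j , λ _ → refl)) (≰⇒> u≰0) (u≤1 (Conv-member g j))

      -- T is the largest t with -(u + t e*_l) ∈ P*; the bound is attained at the generator g j*.
      module PositiveCoordinate (l : Fin d) where

        g : Fin k → Vect d
        g j = embed (gens j)

        f : Fin k → ℚ
        f j = coord l (g j)

        ratio : Fin k → ℚ
        ratio j = (1ℚ - ⟨ u , g j ⟩) * f j ⁻¹

        ratio*f : ∀ {j} → 0ℚ < f j → ratio j * f j ≡ 1ℚ - ⟨ u , g j ⟩
        ratio*f {j} fⱼ>0 = trans (*-assoc (1ℚ - ⟨ u , g j ⟩) (f j ⁻¹) (f j))
          (trans (cong ((1ℚ - ⟨ u , g j ⟩) *_) (⁻¹-inverseˡ (>⇒≢ fⱼ>0))) (*-identityʳ _))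

        minimiser : ∃ λ j → 0ℚ < f j × (∀ j′ → 0ℚ < f j′ → ratio j ≤ ratio j′)
        minimiser = [ (λ f≤0 → ⊥-elim (<-irrefl refl (<-≤-trans 0<1 (eₗ-coord≤0 f≤0)))) , id ]′
                      (argmin-over-positive f ratio)
          where
          eₗ-coord≤0 : (∀ j → f j ≤ 0ℚ) → 1ℚ ≤ 0ℚ
          eₗ-coord≤0 f≤0 = subst (_≤ 0ℚ) (trans (dual l l) (δ-refl l)) (Conv-upperBound (e* l) 0ℚ f≤0 (e∈P l))

        j* : Fin k
        j* = proj₁ minimiser

        f*>0 : 0ℚ < f j*
        f*>0 = proj₁ (proj₂ minimiser)

        T : ℚ
        T = ratio j*

        u-at-j*<1 : ⟨ u , g j* ⟩ < 1ℚ
        u-at-j*<1 = ≤∧≢⇒< (u≤1 (Conv-member g j*)) λ u≡1 →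
          <-irrefl refl (<-≤-trans f*>0 (-F-coord-nonPos l (u≡1⇒-F (Conv-member g j*) u≡1)))

        T>0 : 0ℚ < T
        T>0 = 0<* (<⇒0<- u-at-j*<1) (⁻¹-pos f*>0)

        open SignedShift (inj₂ refl) T l public

        below-1 : ∀ j → ⟨ u , g j ⟩ + T * f j ≤ 1ℚ
        below-1 j = by-sign (0ℚ <? f j)
          where
          by-sign : Dec (0ℚ < f j) → ⟨ u , g j ⟩ + T * f j ≤ 1ℚ
          by-sign (yes fⱼ>0) = begin
            ⟨ u , g j ⟩ + T * f j
              ≤⟨ +-monoʳ-≤ ⟨ u , g j ⟩ (*-monoʳ-≤-nonNeg (f j) {{nonNegative (<⇒≤ fⱼ>0)}} (proj₂ (proj₂ minimiser) j fⱼ>0)) ⟩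
            ⟨ u , g j ⟩ + ratio j * f j       ≡⟨ cong (⟨ u , g j ⟩ +_) (ratio*f fⱼ>0) ⟩
            ⟨ u , g j ⟩ + (1ℚ - ⟨ u , g j ⟩)  ≡⟨ x+[1-x]≡1 (⟨ u , g j ⟩) ⟩
            1ℚ                                ∎
            where
            open ≤-Reasoning
            x+[1-x]≡1 : ∀ x → x + (1ℚ - x) ≡ 1ℚ
            x+[1-x]≡1 = solve-∀ ℚ-ring
          by-sign (no fⱼ≯0) = begin
            ⟨ u , g j ⟩ + T * f j   ≤⟨ +-monoʳ-≤ ⟨ u , g j ⟩ (*-monoˡ-≤-nonNeg T {{nonNegative (<⇒≤ T>0)}} (≮⇒≥ fⱼ≯0)) ⟩
            ⟨ u , g j ⟩ + T * 0ℚ    ≡⟨ trans (cong (⟨ u , g j ⟩ +_) (*-zeroʳ T)) (+-identityʳ ⟨ u , g j ⟩) ⟩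
            ⟨ u , g j ⟩             ≤⟨ u≤1 (Conv-member g j) ⟩
            1ℚ                      ∎
            where open ≤-Reasoning

        w∈P* : Dual P w
        w∈P* y y∈P = Conv-lowerBound w -1ℚ at-generator y∈P
          where
          at-generator : ∀ j → -1ℚ ≤ ⟨ w , g j ⟩
          at-generator j = subst (-1ℚ ≤_) (sym (trans (w-pairing (g j)) (-1ℚ·V≋-V (λ _ → ⟨ u , g j ⟩ + T * f j) l)))
                             (neg-antimono-≤ (below-1 j))

        w-tight-at-j* : Face P w (g j*)
        w-tight-at-j* = Conv-member g j* , (begin
          ⟨ w , g j* ⟩                                   ≡⟨ w-pairing (g j*) ⟩
          -1ℚ * (⟨ u , g j* ⟩ + T * f j*)                ≡⟨ cong (λ t → -1ℚ * (⟨ u , g j* ⟩ + t)) (ratio*f f*>0) ⟩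
          -1ℚ * (⟨ u , g j* ⟩ + (1ℚ - ⟨ u , g j* ⟩))     ≡⟨ -1*[x+[1-x]]≡-1 (⟨ u , g j* ⟩) ⟩
          -1ℚ                                            ∎)
          where
          open ≡-Reasoning
          -1*[x+[1-x]]≡-1 : ∀ x → -1ℚ * (x + (1ℚ - x)) ≡ -1ℚ
          -1*[x+[1-x]]≡-1 = solve-∀ ℚ-ring

      module Vertex (simplicial : IsSimplicial P) {v : Vect d} (v-vertex : IsVertex P v) (uv≡0 : ⟨ u , v ⟩ ≡ 0ℚ)
        {q : Fin d → ℚ} (v≋ : v ≋ ΣV (λ i → q i ·V e i)) where

        coord-v : ∀ i → coord i v ≡ q i
        coord-v i = trans (⟨⟩-congʳ (e* i) v≋) (coord-combination i q)

        Σq≡0 : Σℚ q ≡ 0ℚ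
        Σq≡0 = neg-injective (begin
          - Σℚ q                    ≡⟨ cong -_ (Σℚ-cong coord-v) ⟨
          - Σℚ (λ l → coord l v)    ≡⟨ u-coords v ⟨
          ⟨ u , v ⟩                 ≡⟨ uv≡0 ⟩
          0ℚ                        ∎)
          where open ≡-Reasoning

        v≢signed-e : ∀ {s} m → IsSign s → v ≋ (s ·V e m) → ⊥
        v≢signed-e {s} m s-sign v≋se = IsSign⇒≢0 s-sign (*-cancelˡ-≡ {c = 0ℚ} -1≢0 (begin
          -1ℚ * s              ≡⟨ *-comm -1ℚ s ⟩
          s * -1ℚ              ≡⟨ cong (s *_) (u-eta (e m) (e∈F m)) ⟨
          s * ⟨ u , e m ⟩      ≡⟨ ⟨⟩-*ʳ u s (e m) ⟨
          ⟨ u , s ·V e m ⟩     ≡⟨ ⟨⟩-congʳ u v≋se ⟨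
          ⟨ u , v ⟩            ≡⟨ uv≡0 ⟩
          0ℚ                   ≡⟨ *-zeroʳ -1ℚ ⟨
          -1ℚ * 0ℚ             ∎))
          where open ≡-Reasoning

        module _ (σ : Fin d → ℚ) (σ-sign : ∀ m → IsSign (σ m)) where

          signed-points : Fin (suc d) → Vect d
          signed-points zero = v
          signed-points (suc m) = σ m ·V e m

          signed-points-injective : ∀ j j′ → signed-points j ≋ signed-points j′ → j ≡ j′
          signed-points-injective zero zero _ = refl
          signed-points-injective zero (suc m) v≋ = ⊥-elim (v≢signed-e m (σ-sign m) v≋)
          signed-points-injective (suc m) zero ≋v = ⊥-elim (v≢signed-e m (σ-sign m) (λ k → sym (≋v k)))
          signed-points-injective (suc m) (suc m′) ≋ = cong suc (signed-basis-injective σ σ-sign m m′ ≋)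

          signed-relation : Fin (suc d) → ℚ
          signed-relation zero = 1ℚ
          signed-relation (suc m) = - (q m * σ m)

          signed-relation-vanishes : ΣV (λ j → signed-relation j ·V signed-points j) ≋ zeroV
          signed-relation-vanishes k = begin
            1ℚ * v k + ΣV (λ m → (- (q m * σ m)) ·V (σ m ·V e m)) k
              ≡⟨ cong₂ _+_ (*-identityˡ (v k)) (ΣV-coord (λ m → (- (q m * σ m)) ·V (σ m ·V e m)) k) ⟩
            v k + Σℚ (λ m → - (q m * σ m) * (σ m * e m k))
              ≡⟨ cong₂ _+_ (trans (v≋ k) (ΣV-coord (λ m → q m ·V e m) k))
                           (Σℚ-cong (λ m → cancel-sign (q m) (σ m) (e m k) (IsSign-squared (σ-sign m)))) ⟩
            Σℚ (λ m → q m * e m k) + Σℚ (λ m → - (q m * e m k))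
              ≡⟨ cong (Σℚ (λ m → q m * e m k) +_) (Σℚ-neg (λ m → q m * e m k)) ⟩
            Σℚ (λ m → q m * e m k) - Σℚ (λ m → q m * e m k)
              ≡⟨ +-inverseʳ (Σℚ (λ m → q m * e m k)) ⟩
            0ℚ ∎
            where
            open ≡-Reasoning
            cancel-sign : ∀ a s x → s * s ≡ 1ℚ → - (a * s) * (s * x) ≡ - (a * x)
            cancel-sign a s x s²≡1 = begin
              - (a * s) * (s * x)    ≡⟨ solve (a ∷ s ∷ x ∷ []) ℚ-ring ⟩
              - (s * s * (a * x))    ≡⟨ cong (λ t → - (t * (a * x))) s²≡1 ⟩
              - (1ℚ * (a * x))       ≡⟨ cong -_ (*-identityˡ (a * x)) ⟩
              - (a * x)              ∎

          -- If Σ σ_m q_m = 1, signed-relation is a nontrivial affine relation among d + 1 distinct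
          -- vertices of G.
          no-signed-relation : ∀ {G} → IsFacet P G → (∀ m → G (σ m ·V e m)) → G v →
            Σℚ (λ m → σ m * q m) ≢ 1ℚ
          no-signed-relation {G} G-facet σe∈G v∈G Σσq≡1 = 1≢0 (simplicial G G-facet (suc d) signed-points
            signed-points-injective points-in-G signed-relation Σc≡0 signed-relation-vanishes zero)
            where
            open ≡-Reasoning
            points-in-G : ∀ j → IsVertex P (signed-points j) × G (signed-points j)
            points-in-G zero = v-vertex , v∈G
            points-in-G (suc m) = signed-e-vertex m (σ-sign m) , σe∈G m
            Σc≡0 : Σℚ signed-relation ≡ 0ℚ
            Σc≡0 = begin
              1ℚ + Σℚ (λ m → - (q m * σ m))   ≡⟨ cong (1ℚ +_) (Σℚ-neg (λ m → q m * σ m)) ⟩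
              1ℚ - Σℚ (λ m → q m * σ m)       ≡⟨ cong (λ t → 1ℚ - t) (Σℚ-cong (λ m → *-comm (q m) (σ m))) ⟩
              1ℚ - Σℚ (λ m → σ m * q m)       ≡⟨ cong (λ t → 1ℚ - t) Σσq≡1 ⟩
              1ℚ - 1ℚ                         ≡⟨ +-inverseʳ 1ℚ ⟩
              0ℚ                              ∎

        module _ {ε : ℚ} (ε-sign : IsSign ε) (t : ℚ) (i : Fin d) where
          open SignedShift ε-sign t i

          w-at-v : ⟨ w , v ⟩ ≡ t * (ε * q i)
          w-at-v = begin
            ⟨ w , v ⟩                          ≡⟨ w-pairing v ⟩
            ε * (⟨ u , v ⟩ + t * coord i v)    ≡⟨ cong₂ (λ a b → ε * (a + t * b)) uv≡0 (coord-v i) ⟩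
            ε * (0ℚ + t * q i)                 ≡⟨ rearrange ε t (q i) ⟩
            t * (ε * q i)                      ∎
            where
            open ≡-Reasoning
            rearrange : ∀ ε t q → ε * (0ℚ + t * q) ≡ t * (ε * q)
            rearrange = solve-∀ ℚ-ring

          flipped : Fin d → ℚ
          flipped m = ε * flipAt i m

          flipped-sign : ∀ m → IsSign (flipped m)
          flipped-sign m = IsSign-* ε-sign (flipAt-sign i m)

          flipped-tight : t ≡ 1ℚ + 1ℚ → ∀ m → Face P w (flipped m ·V e m)
          flipped-tight t≡2 m = by-index (i ≟ᶠ m)
            where
            open ≡-Reasoning
            by-index : Dec (i ≡ m) → Face P w (flipped m ·V e m)
            by-index (yes refl) = signed-e∈P i (flipped-sign i) , (begin
              ⟨ w , flipped i ·V e i ⟩         ≡⟨ ⟨⟩-congʳ w (λ k → cong (_* e i k) flippedᵢ≡) ⟩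
              ⟨ w , (-1ℚ * ε) ·V e i ⟩         ≡⟨ w-at-±e-i (inj₂ refl) ⟩
              -1ℚ * (t - 1ℚ)                   ≡⟨ cong (λ s → -1ℚ * (s - 1ℚ)) t≡2 ⟩
              -1ℚ * (1ℚ + 1ℚ - 1ℚ)             ≡⟨⟩
              -1ℚ                              ∎)
              where
              flippedᵢ≡ : flipped i ≡ -1ℚ * ε
              flippedᵢ≡ = trans (cong (ε *_) (flipAt-≡ i)) (*-comm ε -1ℚ)
            by-index (no i≢m) = Face-resp-≋ {x = w} (w-tight-off-i m (i≢m ∘ sym))
              (λ k → cong (_* e m k) (sym (trans (cong (ε *_) (flipAt-≢ i≢m)) (*-identityʳ ε))))

          Σflipped : Σℚ (λ m → flipped m * q m) ≡ - ((1ℚ + 1ℚ) * (ε * q i))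
          Σflipped = begin
            Σℚ (λ m → ε * flipAt i m * q m)         ≡⟨ Σℚ-cong (λ m → *-assoc ε (flipAt i m) (q m)) ⟩
            Σℚ (λ m → ε * (flipAt i m * q m))       ≡⟨ *-distribˡ-Σℚ ε (λ m → flipAt i m * q m) ⟨
            ε * Σℚ (λ m → flipAt i m * q m)         ≡⟨ cong (ε *_) (Σℚ-flipAt i q) ⟩
            ε * (Σℚ q - (1ℚ + 1ℚ) * q i)            ≡⟨ cong (λ s → ε * (s - (1ℚ + 1ℚ) * q i)) Σq≡0 ⟩
            ε * (0ℚ - (1ℚ + 1ℚ) * q i)              ≡⟨ rearrange ε (q i) ⟩
            - ((1ℚ + 1ℚ) * (ε * q i))               ∎
            where
            open ≡-Reasoning
            rearrange : ∀ ε q → ε * (0ℚ - (1ℚ + 1ℚ) * q) ≡ - ((1ℚ + 1ℚ) * (ε * q))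
            rearrange = solve-∀ ℚ-ring

          shift-coordinate : Dual P w → Integral w → 0ℚ < t → ε * q i < 0ℚ → t ≡ 1ℚ × ε * q i ≡ -1ℚ
          shift-coordinate w∈P* w-integral 0<t εqᵢ<0 = by-cases (t-1or2 w∈P* w-integral 0<t)
            where
            t*εq≡-1 : t * (ε * q i) ≡ -1ℚ
            t*εq≡-1 = IsInt-≡-1 (subst IsInt w-at-v (IsInt-⟨⟩ w-integral (vertex-integral v v-vertex)))
              (subst (-1ℚ ≤_) w-at-v (w∈P* v (proj₁ v-vertex)))
              (negative⁻¹ _ {{pos*neg⇒neg t {{positive 0<t}} (ε * q i) {{negative εqᵢ<0}}}})
            by-cases : t ≡ 1ℚ ⊎ t ≡ 1ℚ + 1ℚ → t ≡ 1ℚ × ε * q i ≡ -1ℚ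
            by-cases (inj₁ t≡1) = t≡1 , trans (sym (*-identityˡ (ε * q i))) (trans (cong (_* (ε * q i)) (sym t≡1)) t*εq≡-1)
            by-cases (inj₂ t≡2) = ⊥-elim (no-signed-relation flipped flipped-sign
              (signed-basis-face {w} flipped flipped-sign w∈P* (flipped-tight t≡2) i) (flipped-tight t≡2)
              (proj₁ v-vertex , trans w-at-v t*εq≡-1)
              (trans Σflipped (trans (cong (λ s → - (s * (ε * q i))) (sym t≡2)) (cong -_ t*εq≡-1))))

        module AtAdjacent (i : Fin d) where
          open AdjacentNormal i

          η-at-v : ⟨ η i , v ⟩ ≡ γ i * q i
          η-at-v = trans (η-pairing i v) (trans (cong₂ (λ a b → a + γ i * b) uv≡0 (coord-v i)) (+-identityˡ (γ i * q i)))

          negative-coordinate : q i < 0ℚ → γ i ≡ 1ℚ × q i ≡ -1ℚ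
          negative-coordinate qᵢ<0 = Product.map id (trans (sym (*-identityˡ (q i))))
            (shift-coordinate (inj₁ refl) (γ i) i w∈P* (Integral-resp-≋ η-integral η≋w) (γ>0 i)
              (subst (_< 0ℚ) (sym (*-identityˡ (q i))) qᵢ<0))

          q<0⇔q≡-1 : (q i < 0ℚ) ⇔ (q i ≡ -1ℚ)
          q<0⇔q≡-1 = mk⇔ (proj₂ ∘ negative-coordinate) (λ qᵢ≡-1 → subst (_< 0ℚ) (sym qᵢ≡-1) -1<0)

          q≡-1⇔v∈Fi : (q i ≡ -1ℚ) ⇔ Fi i v
          q≡-1⇔v∈Fi = mk⇔ v∈Fi (λ v∈Fi → proj₂ (negative-coordinate (qᵢ<0 v∈Fi)))
            where
            v∈Fi : q i ≡ -1ℚ → Fi i v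
            v∈Fi qᵢ≡-1 = in-facet (η-normal i) (proj₁ v-vertex) (begin
              ⟨ η i , v ⟩   ≡⟨ η-at-v ⟩
              γ i * q i     ≡⟨ cong₂ _*_ (proj₁ (negative-coordinate (subst (_< 0ℚ) (sym qᵢ≡-1) -1<0))) qᵢ≡-1 ⟩
              1ℚ * -1ℚ      ≡⟨⟩
              -1ℚ           ∎)
              where open ≡-Reasoning
            qᵢ<0 : Fi i v → q i < 0ℚ
            qᵢ<0 v∈Fi = ≰⇒> λ 0≤qᵢ → <-irrefl refl (<-≤-trans -1<0
              (subst (0ℚ ≤_) (trans (sym η-at-v) (on-facet (η-normal i) v∈Fi)) (0≤* (<⇒≤ (γ>0 i)) 0≤qᵢ)))

          e*-description : q i < 0ℚ → (η′ : Vect d) → IsEta (Fi i) η′ →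
            (e* i ≋ (η′ -V u)) × Dual P (e* i) × Integral (e* i)
          e*-description qᵢ<0 η′ η′-eta =
            e*≋η′-u , e*∈P* γ≡1 , Integral-resp-≋ (Integral-minus η-integral u-integral) (λ k → sym (e*≋η-u k))
            where
            γ≡1 : γ i ≡ 1ℚ
            γ≡1 = proj₁ (negative-coordinate qᵢ<0)
            qᵢ≡-1 : q i ≡ -1ℚ
            qᵢ≡-1 = proj₂ (negative-coordinate qᵢ<0)
            v∈Fi : Fi i v
            v∈Fi = to q≡-1⇔v∈Fi qᵢ≡-1
            η′≋η : η′ ≋ η i
            η′≋η = dual-ext-except i (λ vᵢ≡0 → -1≢0 (trans (sym qᵢ≡-1) (trans (sym (coord-v i)) vᵢ≡0)))
              (λ m m≢i → trans (η′-eta (e m) (e∈Fi m≢i)) (sym (on-facet (η-normal i) (e∈Fi m≢i))))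
              (trans (η′-eta v v∈Fi) (sym (on-facet (η-normal i) v∈Fi)))
            e*≋η-u : e* i ≋ (η i -V u)
            e*≋η-u k = sym (begin
              η i k - u k                        ≡⟨ cong (_- u k) (η≋ i k) ⟩
              u k + γ i * e* i k - u k           ≡⟨ cong (λ s → u k + s * e* i k - u k) γ≡1 ⟩
              u k + 1ℚ * e* i k - u k            ≡⟨ cancel (u k) (e* i k) ⟩
              e* i k                             ∎)
              where
              open ≡-Reasoning
              cancel : ∀ a b → a + 1ℚ * b - a ≡ b
              cancel = solve-∀ ℚ-ring
            e*≋η′-u : e* i ≋ (η′ -V u)
            e*≋η′-u k = trans (e*≋η-u k) (cong (_- u k) (sym (η′≋η k)))

        positive-coordinate : ∀ l → 0ℚ < q l → q l ≡ 1ℚ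
        positive-coordinate l 0<qₗ = neg-injective (trans (sym (-1*x≈-x (q l)))
          (proj₂ (shift-coordinate (inj₂ refl) T l w∈P* (w-integral w∈P* w-tight-at-j* (>⇒≢ f*>0)) T>0
            (subst (_< 0ℚ) (sym (-1*x≈-x (q l))) (neg-antimono-< 0<qₗ)))))
          where open PositiveCoordinate l

        q-values : ∀ m → q m ≡ -1ℚ ⊎ q m ≡ 0ℚ ⊎ q m ≡ 1ℚ
        q-values m = by-sign (<-cmp (q m) 0ℚ)
          where
          by-sign : Tri (q m < 0ℚ) (q m ≡ 0ℚ) (0ℚ < q m) → q m ≡ -1ℚ ⊎ q m ≡ 0ℚ ⊎ q m ≡ 1ℚ
          by-sign (tri< qₘ<0 _ _) = inj₁ (proj₂ (AtAdjacent.negative-coordinate m qₘ<0))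
          by-sign (tri≈ _ qₘ≡0 _) = inj₂ (inj₁ qₘ≡0)
          by-sign (tri> _ _ qₘ>0) = inj₂ (inj₂ (positive-coordinate m qₘ>0))

lemma3p1 : (d k : ℕ) (gens : Fin k → Fin d → ℤ) →
    let P = polytope gens in
    IsReflexive P → IsSimplicial P →
    (F : Pred (Vect d) 0ℓ) → IsFacet P F → IsFacet P (negSet F) →
    (e : Fin d → Vect d) →
    (∀ i → IsVertex P (e i) × F (e i)) →
    (∀ i j → e i ≋ e j → i ≡ j) →
    (∀ v → IsVertex P v → F v → ∃ λ i → v ≋ e i) →
    (estar : Fin d → Vect d) →
    (∀ i j → ⟨ estar i , e j ⟩ ≡ δ i j) →
    (Fi : Fin d → Pred (Vect d) 0ℓ) →
    (∀ i → IsFacet P (Fi i)) →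
    (∀ i y → (Fi i y × F y) ⇔ ConvExcept e i y) →
    (u : Vect d) → IsEta F u →
    (v : Vect d) → IsVertex P v → ⟨ u , v ⟩ ≡ 0ℚ →
    (q : Fin d → ℚ) → v ≋ ΣV (λ i → q i ·V e i) →
    ((i : Fin d) →
       ((q i < 0ℚ) ⇔ (q i ≡ -1ℚ)) ×
       ((q i ≡ -1ℚ) ⇔ Fi i v) ×
       (q i < 0ℚ → (η : Vect d) → IsEta (Fi i) η →
          (estar i ≋ (η -V u)) × Dual P (estar i) × Integral (estar i)))
    ×
    (Σ (Subset d) λ I → Σ (Subset d) λ J →
       (∀ i → i ∈ I → i ∉ J) × (∣ I ∣ ≡ ∣ J ∣) ×
       (v ≋ (ΣSub J e -V ΣSub I e)))
lemma3p1 d k gens (0∈P° , vertices-primitive , dual-lattice) simplicial F F-facet -F-facet e e-vertex∈F _ _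
  e* dual Fi Fi-facet Fi∩F u u-eta v v-vertex uv≡0 q v≋ =
  (λ i → let open AtAdjacent i in q<0⇔q≡-1 , q≡-1⇔v∈Fi , e*-description) ,
  balanced-signed-sum e q q-values Σq≡0 v≋
  where
  open Antipodal gens 0∈P° F-facet -F-facet e (proj₂ ∘ e-vertex∈F) e* dual u u-eta
  open Adjacent Fi Fi-facet Fi∩F
  open Lattice (proj₁ ∘ e-vertex∈F) (λ x x-vertex → proj₁ (vertices-primitive x x-vertex)) dual-lattice
  open Vertex simplicial v-vertex uv≡0 {q} v≋
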